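{- Let $\mathbb{B}$ be a locally cartesian closed category and let $B$ be an internally tiny object of $\mathbb{B}$ (the exponential functor $(-)^B$ has a right adjoint). Let $I$ be an object of $\mathbb{B}$ and $m:A\to I^\ast(B)$ a map in the slice $\mathbb{B}/I$, where $I^\ast(B)$ is the projection $I\times B\to I$. Then the algebraic weak factorisation system cofibrantly generated by $m$ is definable, i.e. the notion of structure on $\operatorname{cod}:\mathbb{B}^\to\to\mathbb{B}$ given by lifting structures against $m$ is definable.
   Context: A lifting structure on a map $f:X\to Y$ of $\mathbb{B}$ against $m$ is a choice, for every map $\sigma:K\to I$ in $\mathbb{B}$ and every commutative square in $\mathbb{B}$ from the pullback $\sigma^\ast(m):\sigma^\ast A\to K\times B$ to $f$, of a diagonal filler, such that the choices are stable under reindexing: for every $\tau:K'\to K$, the filler chosen for the square obtained by precomposing with the canonical map from $(\sigma\tau)^\ast(m)$ to $\sigma^\ast(m)$ is the corresponding precomposite of the filler chosen for the original square. Lifting structures on $f$ induce lifting structures on any pullback $g^\ast(f)$ (factor fillers through the pullback). The notion of structure is definable if the forgetful functor from pairs $(f,s)$ ($s$ a lifting structure on $f$) with structure-compatible pullback squares as morphisms to maps of $\mathbb{B}$ with pullback squares as morphisms has a right adjoint; equivalently, for every $f:X\to Y$ the presheaf on $\mathbb{B}/Y$ sending $g:Z\to Y$ to the set of lifting structures on $g^\ast(f)$ is representable. -}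

module Defs where

open import Level using (Level; _⊔_) renaming (suc to lsuc)
open import Data.Product using (Σ; _×_; _,_; proj₁; proj₂)
open import Relation.Binary.PropositionalEquality using (_≡_; refl; sym; trans; cong; module ≡-Reasoning)

record Category (o ℓ : Level) : Set (lsuc (o ⊔ ℓ)) where
  infixr 9 _∘_
  field
    Obj   : Set o
    Hom   : Obj → Obj → Set ℓ
    id    : ∀ {X} → Hom X X
    _∘_   : ∀ {X Y Z} → Hom Y Z → Hom X Y → Hom X Z
    idˡ   : ∀ {X Y} (f : Hom X Y) → id ∘ f ≡ f
    idʳ   : ∀ {X Y} (f : Hom X Y) → f ∘ id ≡ f
    assoc : ∀ {W X Y Z} (f : Hom Y Z) (g : Hom X Y) (h : Hom W X) →
            (f ∘ g) ∘ h ≡ f ∘ (g ∘ h)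

module Limits {o ℓ} (C : Category o ℓ) where
  open Category C

  record Pullback {X Y Z : Obj} (f : Hom X Z) (g : Hom Y Z) : Set (o ⊔ ℓ) where
    field
      P    : Obj
      p₁   : Hom P X
      p₂   : Hom P Y
      comm : f ∘ p₁ ≡ g ∘ p₂
      ⟨_,_⟩ : ∀ {W} (h : Hom W X) (k : Hom W Y) → .(f ∘ h ≡ g ∘ k) → Hom W P
      β₁   : ∀ {W} {h : Hom W X} {k : Hom W Y} .{e : f ∘ h ≡ g ∘ k} → p₁ ∘ ⟨ h , k ⟩ e ≡ h
      β₂   : ∀ {W} {h : Hom W X} {k : Hom W Y} .{e : f ∘ h ≡ g ∘ k} → p₂ ∘ ⟨ h , k ⟩ e ≡ k
      uniq : ∀ {W} (u v : Hom W P) → p₁ ∘ u ≡ p₁ ∘ v → p₂ ∘ u ≡ p₂ ∘ v → u ≡ v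

  record Terminal : Set (o ⊔ ℓ) where
    field
      ⊤        : Obj
      !        : ∀ {X} → Hom X ⊤
      !-unique : ∀ {X} (h : Hom X ⊤) → h ≡ !

  record FinLim : Set (o ⊔ ℓ) where
    field
      terminal : Terminal
      pullback : ∀ {X Y Z} (f : Hom X Z) (g : Hom Y Z) → Pullback f g

module Constructions {o ℓ} (C : Category o ℓ) (FL : Limits.FinLim C) where
  open Category C
  open Limits C
  open FinLim FL
  open Terminal terminal
  open ≡-Reasoning

  -- the chosen pullback of f along g, i.e. g*(f) : Pb f g → Y
  Pb : ∀ {X Y Z} (f : Hom X Z) (g : Hom Y Z) → Obj
  Pb f g = Pullback.P (pullback f g)

  pr₁ : ∀ {X Y Z} {f : Hom X Z} {g : Hom Y Z} → Hom (Pb f g) X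
  pr₁ {f = f} {g} = Pullback.p₁ (pullback f g)

  pr₂ : ∀ {X Y Z} {f : Hom X Z} {g : Hom Y Z} → Hom (Pb f g) Y
  pr₂ {f = f} {g} = Pullback.p₂ (pullback f g)

  infixl 7 _⊗_
  _⊗_ : Obj → Obj → Obj
  X ⊗ Y = Pb (! {X}) (! {Y})

  prodMap : ∀ {U V} (D : Obj) → Hom U V → Hom (U ⊗ D) (V ⊗ D)
  prodMap {U} {V} D f =
    Pullback.⟨_,_⟩ (pullback (! {V}) (! {D})) (f ∘ pr₁) pr₂
      (trans (!-unique _) (sym (!-unique _)))

  prodMap-∘ : ∀ {U V W} (D : Obj) (f : Hom V W) (g : Hom U V) →
              prodMap D f ∘ prodMap D g ≡ prodMap D (f ∘ g)
  prodMap-∘ {U} {V} {W} D f g = Pullback.uniq (pullback (! {W}) (! {D})) _ _ e1 e2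
    where
      module PW = Pullback (pullback (! {W}) (! {D}))
      module PV = Pullback (pullback (! {V}) (! {D}))
      module PU = Pullback (pullback (! {U}) (! {D}))
      e1 : PW.p₁ ∘ (prodMap D f ∘ prodMap D g) ≡ PW.p₁ ∘ prodMap D (f ∘ g)
      e1 = begin
        PW.p₁ ∘ (prodMap D f ∘ prodMap D g) ≡⟨ sym (assoc _ _ _) ⟩
        (PW.p₁ ∘ prodMap D f) ∘ prodMap D g ≡⟨ cong (_∘ prodMap D g) PW.β₁ ⟩
        (f ∘ PV.p₁) ∘ prodMap D g           ≡⟨ assoc _ _ _ ⟩
        f ∘ (PV.p₁ ∘ prodMap D g)           ≡⟨ cong (f ∘_) PV.β₁ ⟩
        f ∘ (g ∘ PU.p₁)                     ≡⟨ sym (assoc _ _ _) ⟩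
        (f ∘ g) ∘ PU.p₁                     ≡⟨ sym PW.β₁ ⟩
        PW.p₁ ∘ prodMap D (f ∘ g)           ∎
      e2 : PW.p₂ ∘ (prodMap D f ∘ prodMap D g) ≡ PW.p₂ ∘ prodMap D (f ∘ g)
      e2 = begin
        PW.p₂ ∘ (prodMap D f ∘ prodMap D g) ≡⟨ sym (assoc _ _ _) ⟩
        (PW.p₂ ∘ prodMap D f) ∘ prodMap D g ≡⟨ cong (_∘ prodMap D g) PW.β₂ ⟩
        PV.p₂ ∘ prodMap D g                 ≡⟨ PV.β₂ ⟩
        PU.p₂                               ≡⟨ sym PW.β₂ ⟩
        PW.p₂ ∘ prodMap D (f ∘ g)           ∎

  record Exponential (D X : Obj) : Set (o ⊔ ℓ) where
    field
      E     : Obj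
      ev    : Hom (E ⊗ D) X
      curry : ∀ {Z} → Hom (Z ⊗ D) X → Hom Z E
      β     : ∀ {Z} (g : Hom (Z ⊗ D) X) → ev ∘ prodMap D (curry g) ≡ g
      η     : ∀ {Z} (g : Hom (Z ⊗ D) X) (k : Hom Z E) →
              ev ∘ prodMap D k ≡ g → k ≡ curry g

  -- Dependent products: a right adjoint to pullback f* : B/Y → B/X,
  -- given pointwise by a universal arrow (counit) for each object p : E → X.

  fstar : ∀ {X Y Z P} (f : Hom X Y) (q : Hom P Y) (r : Hom Z Y) (k : Hom Z P) →
          .(q ∘ k ≡ r) → Hom (Pb r f) (Pb q f)
  fstar f q r k e =
    Pullback.⟨_,_⟩ (pullback q f) (k ∘ pr₁) pr₂
      (trans (sym (assoc _ _ _))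
        (trans (cong (_∘ pr₁) e) (Pullback.comm (pullback r f))))

  record DepProd {X Y E : Obj} (f : Hom X Y) (p : Hom E X) : Set (o ⊔ ℓ) where
    field
      P      : Obj
      q      : Hom P Y
      ε      : Hom (Pb q f) E
      ε-over : p ∘ ε ≡ pr₂
      univ   : ∀ {Z} (r : Hom Z Y) (h : Hom (Pb r f) E) → p ∘ h ≡ pr₂ →
               Σ (Hom Z P) λ k → Σ (q ∘ k ≡ r) λ e →
                 (ε ∘ fstar f q r k e ≡ h) ×
                 (∀ (k' : Hom Z P) (e' : q ∘ k' ≡ r) → ε ∘ fstar f q r k' e' ≡ h → k' ≡ k)

  -- Locally cartesian closed structure on a category with finite limits:
  -- every pullback functor has a right adjoint (and, as the case over the
  -- terminal object, chosen exponentials).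
  record LCCCStr : Set (o ⊔ ℓ) where
    field
      Π   : ∀ {X Y E} (f : Hom X Y) (p : Hom E X) → DepProd f p
      exp : ∀ (D X : Obj) → Exponential D X

  module _ (L : LCCCStr) where
    open LCCCStr L

    expObj : Obj → Obj → Obj
    expObj D X = Exponential.E (exp D X)

    expMap : ∀ (D : Obj) {X X'} → Hom X X' → Hom (expObj D X) (expObj D X')
    expMap D {X} {X'} k = Exponential.curry (exp D X') (k ∘ Exponential.ev (exp D X))

    -- D is internally tiny: (-)^D has a right adjoint, given pointwise by
    -- a terminal object of the comma category ((-)^D ↓ Y) for every Y.
    IsTiny : Obj → Set (o ⊔ ℓ)
    IsTiny D = ∀ (Y : Obj) → Σ Obj λ R → Σ (Hom (expObj D R) Y) λ ε →
      ∀ (X : Obj) (g : Hom (expObj D X) Y) →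
        Σ (Hom X R) λ k → (ε ∘ expMap D k ≡ g) ×
          (∀ (k' : Hom X R) → ε ∘ expMap D k' ≡ g → k' ≡ k)

  -- Lifting structures against m : A → I × B  (a map in B/I to I*(B))

  module Lifting (I B A : Obj) (m : Hom A (I ⊗ B)) where

    σA : ∀ {K} → Hom K I → Obj
    σA σ = Pb m (prodMap B σ)

    σm : ∀ {K} (σ : Hom K I) → Hom (σA σ) (K ⊗ B)
    σm σ = pr₂ {f = m} {g = prodMap B σ}

    -- the top component of the canonical map (στ)*(m) → σ*(m)
    reTop : ∀ {K K'} (σ : Hom K I) (τ : Hom K' K) → Hom (σA (σ ∘ τ)) (σA σ)
    reTop σ τ =
      Pullback.⟨_,_⟩ (pullback m (prodMap B σ))
        (pr₁ {f = m} {g = prodMap B (σ ∘ τ)}) (prodMap B τ ∘ σm (σ ∘ τ))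
        (trans (Pullback.comm (pullback m (prodMap B (σ ∘ τ))))
          (trans (cong (_∘ σm (σ ∘ τ)) (sym (prodMap-∘ B σ τ)))
                 (assoc _ _ _)))

    reSq : ∀ {X Y K K'} (f : Hom X Y) (σ : Hom K I) (τ : Hom K' K)
             (a : Hom (σA σ) X) (b : Hom (K ⊗ B) Y) → f ∘ a ≡ b ∘ σm σ →
             f ∘ (a ∘ reTop σ τ) ≡ (b ∘ prodMap B τ) ∘ σm (σ ∘ τ)
    reSq f σ τ a b e = begin
      f ∘ (a ∘ reTop σ τ)             ≡⟨ sym (assoc _ _ _) ⟩
      (f ∘ a) ∘ reTop σ τ             ≡⟨ cong (_∘ reTop σ τ) e ⟩
      (b ∘ σm σ) ∘ reTop σ τ          ≡⟨ assoc _ _ _ ⟩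
      b ∘ (σm σ ∘ reTop σ τ)          ≡⟨ cong (b ∘_) (Pullback.β₂ (pullback m (prodMap B σ))) ⟩
      b ∘ (prodMap B τ ∘ σm (σ ∘ τ))  ≡⟨ sym (assoc _ _ _) ⟩
      (b ∘ prodMap B τ) ∘ σm (σ ∘ τ)  ∎

    record LiftStr {X Y : Obj} (f : Hom X Y) : Set (o ⊔ ℓ) where
      field
        fill   : ∀ {K} (σ : Hom K I) (a : Hom (σA σ) X) (b : Hom (K ⊗ B) Y) →
                 .(f ∘ a ≡ b ∘ σm σ) → Hom (K ⊗ B) X
        up     : ∀ {K} (σ : Hom K I) (a : Hom (σA σ) X) (b : Hom (K ⊗ B) Y)
                 .(e : f ∘ a ≡ b ∘ σm σ) → fill σ a b e ∘ σm σ ≡ a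
        down   : ∀ {K} (σ : Hom K I) (a : Hom (σA σ) X) (b : Hom (K ⊗ B) Y)
                 .(e : f ∘ a ≡ b ∘ σm σ) → f ∘ fill σ a b e ≡ b
        stable : ∀ {K K'} (σ : Hom K I) (τ : Hom K' K)
                 (a : Hom (σA σ) X) (b : Hom (K ⊗ B) Y) (e : f ∘ a ≡ b ∘ σm σ) →
                 fill (σ ∘ τ) (a ∘ reTop σ τ) (b ∘ prodMap B τ) (reSq f σ τ a b e)
                   ≡ fill σ a b e ∘ prodMap B τ

    module _ {X Y : Obj} (f : Hom X Y) where

      Ph : ∀ {Z Z₀} (g : Hom Z Y) (g₀ : Hom Z₀ Y) (h : Hom Z Z₀) →
           .(g₀ ∘ h ≡ g) → Hom (Pb f g) (Pb f g₀)
      Ph g g₀ h e =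
        Pullback.⟨_,_⟩ (pullback f g₀) pr₁ (h ∘ pr₂)
          (trans (Pullback.comm (pullback f g))
            (trans (cong (_∘ pr₂) (sym e)) (assoc _ _ _)))

      PhSq : ∀ {Z Z₀ K} (g : Hom Z Y) (g₀ : Hom Z₀ Y) (h : Hom Z Z₀)
             (e : g₀ ∘ h ≡ g) (σ : Hom K I)
             (a : Hom (σA σ) (Pb f g)) (b : Hom (K ⊗ B) Z) →
             pr₂ {f = f} {g = g} ∘ a ≡ b ∘ σm σ →
             pr₂ {f = f} {g = g₀} ∘ (Ph g g₀ h e ∘ a) ≡ (h ∘ b) ∘ σm σ
      PhSq g g₀ h e σ a b e' = begin
        pr₂ ∘ (Ph g g₀ h e ∘ a)  ≡⟨ sym (assoc _ _ _) ⟩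
        (pr₂ ∘ Ph g g₀ h e) ∘ a  ≡⟨ cong (_∘ a) (Pullback.β₂ (pullback f g₀)) ⟩
        (h ∘ pr₂) ∘ a            ≡⟨ assoc _ _ _ ⟩
        h ∘ (pr₂ ∘ a)            ≡⟨ cong (h ∘_) e' ⟩
        h ∘ (b ∘ σm σ)           ≡⟨ sym (assoc _ _ _) ⟩
        (h ∘ b) ∘ σm σ           ∎

      -- s (on g*(f)) is the lifting structure induced from s₀ (on g₀*(f))
      -- along h: the fillers of s are those of s₀ factored through the pullback.
      IsRestriction : ∀ {Z Z₀} (g : Hom Z Y) (g₀ : Hom Z₀ Y) (h : Hom Z Z₀)
                      (e : g₀ ∘ h ≡ g) →
                      LiftStr (pr₂ {f = f} {g = g}) → LiftStr (pr₂ {f = f} {g = g₀}) →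
                      Set (o ⊔ ℓ)
      IsRestriction g g₀ h e s s₀ =
        ∀ {K} (σ : Hom K I) (a : Hom (σA σ) (Pb f g)) (b : Hom (K ⊗ B) _)
          (e' : pr₂ {f = f} {g = g} ∘ a ≡ b ∘ σm σ) →
          Ph g g₀ h e ∘ LiftStr.fill s σ a b e'
            ≡ LiftStr.fill s₀ σ (Ph g g₀ h e ∘ a) (h ∘ b) (PhSq g g₀ h e σ a b e')

      -- the presheaf  (g : Z → Y) ↦ LiftStr (g*(f))  on B/Y is representable,
      -- expressed by a universal element (Yoneda).
      RepresentableLiftStr : Set (o ⊔ ℓ)
      RepresentableLiftStr =
        Σ Obj λ Z₀ → Σ (Hom Z₀ Y) λ g₀ → Σ (LiftStr (pr₂ {f = f} {g = g₀})) λ s₀ →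
          ∀ {Z} (g : Hom Z Y) (s : LiftStr (pr₂ {f = f} {g = g})) →
            Σ (Hom Z Z₀) λ h → Σ (g₀ ∘ h ≡ g) λ e →
              IsRestriction g g₀ h e s s₀ ×
              (∀ (h' : Hom Z Z₀) (e' : g₀ ∘ h' ≡ g) →
                 IsRestriction g g₀ h' e' s s₀ → h' ≡ h)

    Definable : Set (o ⊔ ℓ)
    Definable = ∀ {X Y : Obj} (f : Hom X Y) → RepresentableLiftStr f

{-# OPTIONS --safe #-}
-- Over V = I × Y^B sits the generic square from σ*(m) to f, with bottom edge named by a point
-- of Y^B. A dependent product along it followed by a pullback gives an object Prob whose maps
-- K → Prob are exactly the squares from σ*(m) to f at stages σ : K → I, naturally in K.
-- A point (σ, δ) of Ω = I × X^B names a problem that δ fills, so a reindexing-stable choice of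
-- fillers for the squares against g*(f), g : Z → Y, is the same as a map Z^B → W = Π_{Prob → Y^B} Ω
-- over Y^B: its value at the generic square over the problems with bottom edge through g^B
-- determines all the others by stability.
-- As B is tiny, maps Z^B → W over Y^B are maps Z → Z₀ over Y, where Z₀ is the pullback of
-- R W → R(Y^B) along the unit Y → R(Y^B); so Z₀ → Y represents lifting structures.
module Submission where

open import Defs
open import Level using (Level)
open import Data.Product using (Σ; _×_; _,_; proj₁; proj₂)
open import Relation.Binary.PropositionalEquality using (_≡_; refl; sym; trans; cong; module ≡-Reasoning)

module _ {o ℓ} (C : Category o ℓ) (FL : Limits.FinLim C) where
  open Category C
  open Limits C
  open Limits.FinLim FL
  open Terminal terminal
  open Constructions C FL
  open ≡-Reasoning

  -- The pairing of the pullback of id along id consumes its equation irrelevantly,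
  -- yet its two projections still compute to x and y.
  unsquash : ∀ {W Z} {x y : Hom W Z} → .(x ≡ y) → x ≡ y
  unsquash {W} {Z} {x} {y} e = begin
      x                  ≡⟨ sym P.β₁ ⟩
      P.p₁ ∘ u           ≡⟨ sym (idˡ _) ⟩
      id ∘ (P.p₁ ∘ u)    ≡⟨ sym (assoc _ _ _) ⟩
      (id ∘ P.p₁) ∘ u    ≡⟨ cong (_∘ u) P.comm ⟩
      (id ∘ P.p₂) ∘ u    ≡⟨ assoc _ _ _ ⟩
      id ∘ (P.p₂ ∘ u)    ≡⟨ idˡ _ ⟩
      P.p₂ ∘ u           ≡⟨ P.β₂ ⟩
      y                  ∎
    where
      module P = Pullback (pullback (id {Z}) (id {Z}))
      u : Hom W P.P
      u = P.⟨ x , y ⟩ (cong (id ∘_) e)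

  pullˡ : ∀ {W X Y Z} {f : Hom Y Z} {g : Hom X Y} {h : Hom X Z} (k : Hom W X) →
          f ∘ g ≡ h → f ∘ (g ∘ k) ≡ h ∘ k
  pullˡ {f = f} {g} k e = trans (sym (assoc f g k)) (cong (_∘ k) e)

  module PullbackFacts {X Y Z} {f : Hom X Z} {g : Hom Y Z} (PP : Pullback f g) where
    open Pullback PP

    ⟨⟩-unique : ∀ {W} {h : Hom W X} {k : Hom W Y} .{e : f ∘ h ≡ g ∘ k} (u : Hom W P) →
                p₁ ∘ u ≡ h → p₂ ∘ u ≡ k → u ≡ ⟨ h , k ⟩ e
    ⟨⟩-unique u e₁ e₂ = uniq _ _ (trans e₁ (sym β₁)) (trans e₂ (sym β₂))

    ⟨⟩-cong₂ : ∀ {W} {h h' : Hom W X} {k k' : Hom W Y}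
               .{e : f ∘ h ≡ g ∘ k} .{e' : f ∘ h' ≡ g ∘ k'} →
               h ≡ h' → k ≡ k' → ⟨ h , k ⟩ e ≡ ⟨ h' , k' ⟩ e'
    ⟨⟩-cong₂ refl refl = refl

    ⟨⟩∘ : ∀ {V W} {h : Hom W X} {k : Hom W Y} .{e : f ∘ h ≡ g ∘ k} (t : Hom V W) →
          ⟨ h , k ⟩ e ∘ t
            ≡ ⟨ h ∘ t , k ∘ t ⟩ (trans (sym (assoc _ _ _)) (trans (cong (_∘ t) (unsquash e)) (assoc _ _ _)))
    ⟨⟩∘ t = ⟨⟩-unique _ (pullˡ t β₁) (pullˡ t β₂)

    comm∘ : ∀ {W} (u : Hom W P) → f ∘ (p₁ ∘ u) ≡ g ∘ (p₂ ∘ u)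
    comm∘ u = trans (sym (assoc _ _ _)) (trans (cong (_∘ u) comm) (assoc _ _ _))

  π₁ : ∀ {U D} → Hom (U ⊗ D) U
  π₁ {U} {D} = pr₁ {f = ! {U}} {g = ! {D}}

  π₂ : ∀ {U D} → Hom (U ⊗ D) D
  π₂ {U} {D} = pr₂ {f = ! {U}} {g = ! {D}}

  pair : ∀ {W U D} → Hom W U → Hom W D → Hom W (U ⊗ D)
  pair {U = U} {D} h k =
    Pullback.⟨_,_⟩ (pullback (! {U}) (! {D})) h k (trans (!-unique _) (sym (!-unique _)))

  π₁∘pair : ∀ {W U D} {h : Hom W U} {k : Hom W D} → π₁ ∘ pair h k ≡ h
  π₁∘pair {U = U} {D} = Pullback.β₁ (pullback (! {U}) (! {D}))

  π₂∘pair : ∀ {W U D} {h : Hom W U} {k : Hom W D} → π₂ ∘ pair h k ≡ k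
  π₂∘pair {U = U} {D} = Pullback.β₂ (pullback (! {U}) (! {D}))

  pair-unique : ∀ {W U D} {h : Hom W U} {k : Hom W D} (u : Hom W (U ⊗ D)) →
                π₁ ∘ u ≡ h → π₂ ∘ u ≡ k → u ≡ pair h k
  pair-unique {U = U} {D} = PullbackFacts.⟨⟩-unique (pullback (! {U}) (! {D}))

  ⊗-ext : ∀ {W U D} (u v : Hom W (U ⊗ D)) → π₁ ∘ u ≡ π₁ ∘ v → π₂ ∘ u ≡ π₂ ∘ v → u ≡ v
  ⊗-ext {U = U} {D} = Pullback.uniq (pullback (! {U}) (! {D}))

  prodMap-id : ∀ {U} (D : Obj) → prodMap D (id {U}) ≡ id
  prodMap-id {U} D = sym (⊗-ext _ _
    (trans (idʳ _) (trans (sym (idˡ _)) (sym (Pullback.β₁ (pullback (! {U}) (! {D}))))))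
    (trans (idʳ _) (sym (Pullback.β₂ (pullback (! {U}) (! {D}))))))

  prodMap-∘≡ : ∀ {U V W} (D : Obj) {f : Hom V W} {g : Hom U V} {h : Hom U W} → f ∘ g ≡ h →
               prodMap D f ∘ prodMap D g ≡ prodMap D h
  prodMap-∘≡ D {f} {g} refl = prodMap-∘ D f g

  prodMap-cong : ∀ {U V} (D : Obj) {f g : Hom U V} → f ≡ g → prodMap D f ≡ prodMap D g
  prodMap-cong D refl = refl

  module ExponentialFacts (Lc : LCCCStr) where
    open LCCCStr Lc

    module Exp (D X : Obj) where
      open Exponential (exp D X) public

      curry∘ : ∀ {Z Z'} (g : Hom (Z ⊗ D) X) (t : Hom Z' Z) → curry g ∘ t ≡ curry (g ∘ prodMap D t)
      curry∘ g t = η _ _ (begin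
        ev ∘ prodMap D (curry g ∘ t)               ≡⟨ cong (ev ∘_) (sym (prodMap-∘ D _ _)) ⟩
        ev ∘ (prodMap D (curry g) ∘ prodMap D t)   ≡⟨ pullˡ _ (β g) ⟩
        g ∘ prodMap D t                            ∎)

      curry-ev : ∀ {Z} (k : Hom Z E) → curry (ev ∘ prodMap D k) ≡ k
      curry-ev k = sym (η _ k refl)

      curry-injective : ∀ {Z} {g g' : Hom (Z ⊗ D) X} → curry g ≡ curry g' → g ≡ g'
      curry-injective {g = g} {g'} e =
        trans (sym (β g)) (trans (cong (λ k → ev ∘ prodMap D k) e) (β g'))

      curry-cong : ∀ {Z} {g g' : Hom (Z ⊗ D) X} → g ≡ g' → curry g ≡ curry g'
      curry-cong refl = refl

    expMap∘curry : ∀ (D : Obj) {X X' Z} (k : Hom X X') (g : Hom (Z ⊗ D) X) →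
                   expMap Lc D k ∘ Exp.curry D X g ≡ Exp.curry D X' (k ∘ g)
    expMap∘curry D {X} {X'} k g = begin
      Exp.curry D X' (k ∘ Exp.ev D X) ∘ Exp.curry D X g
        ≡⟨ Exp.curry∘ D X' _ _ ⟩
      Exp.curry D X' ((k ∘ Exp.ev D X) ∘ prodMap D (Exp.curry D X g))
        ≡⟨ Exp.curry-cong D X' (trans (assoc _ _ _) (cong (k ∘_) (Exp.β D X g))) ⟩
      Exp.curry D X' (k ∘ g) ∎

    expMap-∘ : ∀ (D : Obj) {X X' X''} (k : Hom X' X'') (k' : Hom X X') →
               expMap Lc D (k ∘ k') ≡ expMap Lc D k ∘ expMap Lc D k'
    expMap-∘ D k k' = sym (trans (expMap∘curry D k _) (Exp.curry-cong D _ (sym (assoc _ _ _))))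

    ev∘expMap : ∀ (D : Obj) {X X' K} (k : Hom X X') (δ : Hom K (expObj Lc D X)) →
                Exp.ev D X' ∘ prodMap D (expMap Lc D k ∘ δ) ≡ k ∘ (Exp.ev D X ∘ prodMap D δ)
    ev∘expMap D {X} {X'} k δ = begin
      Exp.ev D X' ∘ prodMap D (expMap Lc D k ∘ δ)                 ≡⟨ cong (Exp.ev D X' ∘_) (sym (prodMap-∘ D _ _)) ⟩
      Exp.ev D X' ∘ (prodMap D (expMap Lc D k) ∘ prodMap D δ)     ≡⟨ pullˡ _ (Exp.β D X' _) ⟩
      (k ∘ Exp.ev D X) ∘ prodMap D δ                              ≡⟨ assoc _ _ _ ⟩
      k ∘ (Exp.ev D X ∘ prodMap D δ)                              ∎

  module ReindexingFacts (I B A : Obj) (m : Hom A (I ⊗ B)) where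
    open Lifting I B A m

    σp : ∀ {K} (σ : Hom K I) → Hom (σA σ) A
    σp σ = pr₁ {f = m} {g = prodMap B σ}

    σA-ext : ∀ {K W} (σ : Hom K I) (u v : Hom W (σA σ)) →
             σp σ ∘ u ≡ σp σ ∘ v → σm σ ∘ u ≡ σm σ ∘ v → u ≡ v
    σA-ext σ = Pullback.uniq (pullback m (prodMap B σ))

    -- reTop σ τ, generalised to a σ' that is only equal to σ ∘ τ
    reindex : ∀ {K K'} (σ' : Hom K' I) (σ : Hom K I) (τ : Hom K' K) → .(σ ∘ τ ≡ σ') →
              Hom (σA σ') (σA σ)
    reindex σ' σ τ e = Pullback.⟨_,_⟩ (pullback m (prodMap B σ)) (σp σ') (prodMap B τ ∘ σm σ')
      (trans (Pullback.comm (pullback m (prodMap B σ')))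
        (trans (cong (_∘ σm σ') (sym (prodMap-∘≡ B (unsquash e)))) (assoc _ _ _)))

    σp∘reindex : ∀ {K K'} (σ' : Hom K' I) (σ : Hom K I) (τ : Hom K' K) .(e : σ ∘ τ ≡ σ') →
                 σp σ ∘ reindex σ' σ τ e ≡ σp σ'
    σp∘reindex σ' σ τ e = Pullback.β₁ (pullback m (prodMap B σ))

    σm∘reindex : ∀ {K K'} (σ' : Hom K' I) (σ : Hom K I) (τ : Hom K' K) .(e : σ ∘ τ ≡ σ') →
                 σm σ ∘ reindex σ' σ τ e ≡ prodMap B τ ∘ σm σ'
    σm∘reindex σ' σ τ e = Pullback.β₂ (pullback m (prodMap B σ))

    reindex-id : ∀ {K} (σ : Hom K I) .(e : σ ∘ id ≡ σ) → reindex σ σ id e ≡ id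
    reindex-id σ e = σA-ext σ _ _
      (trans (σp∘reindex σ σ id e) (sym (idʳ _)))
      (trans (σm∘reindex σ σ id e) (trans (cong (_∘ σm σ) (prodMap-id B)) (trans (idˡ _) (sym (idʳ _)))))

    reindex-∘ : ∀ {K K' K''} (σ'' : Hom K'' I) (σ' : Hom K' I) (σ : Hom K I)
                (τ : Hom K' K) (τ' : Hom K'' K')
                .(e : σ ∘ τ ≡ σ') .(e' : σ' ∘ τ' ≡ σ'') .(e'' : σ ∘ (τ ∘ τ') ≡ σ'') →
                reindex σ' σ τ e ∘ reindex σ'' σ' τ' e' ≡ reindex σ'' σ (τ ∘ τ') e''
    reindex-∘ σ'' σ' σ τ τ' e e' e'' = σA-ext σ _ _
      (begin
        σp σ ∘ (reindex σ' σ τ e ∘ reindex σ'' σ' τ' e')  ≡⟨ pullˡ _ (σp∘reindex σ' σ τ e) ⟩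
        σp σ' ∘ reindex σ'' σ' τ' e'                       ≡⟨ σp∘reindex σ'' σ' τ' e' ⟩
        σp σ''                                             ≡⟨ sym (σp∘reindex σ'' σ (τ ∘ τ') e'') ⟩
        σp σ ∘ reindex σ'' σ (τ ∘ τ') e''                  ∎)
      (begin
        σm σ ∘ (reindex σ' σ τ e ∘ reindex σ'' σ' τ' e')   ≡⟨ pullˡ _ (σm∘reindex σ' σ τ e) ⟩
        (prodMap B τ ∘ σm σ') ∘ reindex σ'' σ' τ' e'       ≡⟨ assoc _ _ _ ⟩
        prodMap B τ ∘ (σm σ' ∘ reindex σ'' σ' τ' e')       ≡⟨ cong (prodMap B τ ∘_) (σm∘reindex σ'' σ' τ' e') ⟩
        prodMap B τ ∘ (prodMap B τ' ∘ σm σ'')              ≡⟨ pullˡ _ (prodMap-∘ B τ τ') ⟩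
        prodMap B (τ ∘ τ') ∘ σm σ''                        ≡⟨ sym (σm∘reindex σ'' σ (τ ∘ τ') e'') ⟩
        σm σ ∘ reindex σ'' σ (τ ∘ τ') e''                  ∎)

    reindex-cong : ∀ {K K'} (σ' : Hom K' I) (σ : Hom K I) {τ τ' : Hom K' K}
                   .(e : σ ∘ τ ≡ σ') .(e' : σ ∘ τ' ≡ σ') →
                   τ ≡ τ' → reindex σ' σ τ e ≡ reindex σ' σ τ' e'
    reindex-cong σ' σ e e' refl = refl

    stable-reindex : ∀ {X Y} {F : Hom X Y} (s : LiftStr F) {K K'} (σ : Hom K I) (τ : Hom K' K)
                     {σ' : Hom K' I} (eστ : σ ∘ τ ≡ σ')
                     (a : Hom (σA σ) X) (b : Hom (K ⊗ B) Y) .(e : F ∘ a ≡ b ∘ σm σ)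
                     {a' : Hom (σA σ') X} {b' : Hom (K' ⊗ B) Y} .{e' : F ∘ a' ≡ b' ∘ σm σ'} →
                     a ∘ reindex σ' σ τ eστ ≡ a' → b ∘ prodMap B τ ≡ b' →
                     LiftStr.fill s σ' a' b' e' ≡ LiftStr.fill s σ a b e ∘ prodMap B τ
    stable-reindex s σ τ refl a b e refl refl = LiftStr.stable s σ τ a b (unsquash e)

  module Problems (Lc : LCCCStr) (B I A : Obj) (m : Hom A (I ⊗ B)) {X Y : Obj} (f : Hom X Y) where
    open LCCCStr Lc
    open ExponentialFacts Lc
    open ReindexingFacts I B A m
    open Lifting I B A m

    module EY = Exp B Y
    module EX = Exp B X

    Y^B : Obj
    Y^B = EY.E

    X^B : Obj
    X^B = EX.E

    f^B : Hom X^B Y^B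
    f^B = expMap Lc B f

    V : Obj
    V = I ⊗ Y^B

    πI : Hom V I
    πI = π₁

    πY : Hom V Y^B
    πY = π₂

    mV : Hom (σA πI) (V ⊗ B)
    mV = σm πI

    bottomV : Hom (σA πI) Y
    bottomV = EY.ev ∘ (prodMap B πY ∘ mV)

    module EP = Pullback (pullback f bottomV)
    module ΠE = DepProd (Π mV EP.p₂)
    module PM = Pullback (pullback ΠE.q mV)
    module EM = Exp B ΠE.P
    module EVB = Exp B (V ⊗ B)

    unitV : Hom V EVB.E
    unitV = EVB.curry id

    -- A map K → Prob is a point v : K → V with a section of Π_{mV}(bottomV*(f)) lying over
    -- v × B (this is what the pullback along the unit of V enforces), i.e. a top edge
    -- σ*(A) → X completing the square whose bottom edge v names.
    module ProbP = Pullback (pullback (expMap Lc B ΠE.q) unitV)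

    Prob : Obj
    Prob = ProbP.P

    prob-V : Hom Prob V
    prob-V = ProbP.p₂

    prob-σ : Hom Prob I
    prob-σ = πI ∘ prob-V

    prob-γ : Hom Prob Y^B
    prob-γ = πY ∘ prob-V

    sectionOf : ∀ {K} → Hom K Prob → Hom (K ⊗ B) ΠE.P
    sectionOf u = EM.ev ∘ prodMap B (ProbP.p₁ ∘ u)

    q∘sectionOf : ∀ {K} (u : Hom K Prob) → ΠE.q ∘ sectionOf u ≡ prodMap B (prob-V ∘ u)
    q∘sectionOf u = EVB.curry-injective (begin
      EVB.curry (ΠE.q ∘ sectionOf u)                ≡⟨ sym (expMap∘curry B ΠE.q _) ⟩
      expMap Lc B ΠE.q ∘ EM.curry (sectionOf u)     ≡⟨ cong (expMap Lc B ΠE.q ∘_) (EM.curry-ev _) ⟩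
      expMap Lc B ΠE.q ∘ (ProbP.p₁ ∘ u)             ≡⟨ PullbackFacts.comm∘ (pullback (expMap Lc B ΠE.q) unitV) u ⟩
      unitV ∘ (prob-V ∘ u)                          ≡⟨ EVB.curry∘ _ _ ⟩
      EVB.curry (id ∘ prodMap B (prob-V ∘ u))       ≡⟨ EVB.curry-cong (idˡ _) ⟩
      EVB.curry (prodMap B (prob-V ∘ u))            ∎)

    topPoint : ∀ {K} (v : Hom K V) (w : Hom (K ⊗ B) ΠE.P) .(ew : ΠE.q ∘ w ≡ prodMap B v)
               (σ : Hom K I) .(eσ : πI ∘ v ≡ σ) → Hom (σA σ) (Pb ΠE.q mV)
    topPoint v w ew σ eσ = PM.⟨ w ∘ σm σ , reindex σ πI v eσ ⟩
      (trans (pullˡ _ (unsquash ew)) (sym (σm∘reindex σ πI v eσ)))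

    topOf : ∀ {K} (v : Hom K V) (w : Hom (K ⊗ B) ΠE.P) .(ew : ΠE.q ∘ w ≡ prodMap B v)
            (σ : Hom K I) .(eσ : πI ∘ v ≡ σ) → Hom (σA σ) X
    topOf v w ew σ eσ = EP.p₁ ∘ (ΠE.ε ∘ topPoint v w ew σ eσ)

    topOf-commutes : ∀ {K} (v : Hom K V) (w : Hom (K ⊗ B) ΠE.P) .(ew : ΠE.q ∘ w ≡ prodMap B v)
                     (σ : Hom K I) .(eσ : πI ∘ v ≡ σ) →
                     f ∘ topOf v w ew σ eσ ≡ EY.ev ∘ (prodMap B (πY ∘ v) ∘ σm σ)
    topOf-commutes v w ew σ eσ = begin
      f ∘ (EP.p₁ ∘ (ΠE.ε ∘ x))                             ≡⟨ pullˡ _ EP.comm ⟩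
      (bottomV ∘ EP.p₂) ∘ (ΠE.ε ∘ x)                       ≡⟨ assoc _ _ _ ⟩
      bottomV ∘ (EP.p₂ ∘ (ΠE.ε ∘ x))                       ≡⟨ cong (bottomV ∘_) (pullˡ _ ΠE.ε-over) ⟩
      bottomV ∘ (PM.p₂ ∘ x)                                ≡⟨ cong (bottomV ∘_) PM.β₂ ⟩
      bottomV ∘ r                                          ≡⟨ trans (assoc _ _ _) (cong (EY.ev ∘_) (assoc _ _ _)) ⟩
      EY.ev ∘ (prodMap B πY ∘ (mV ∘ r))                    ≡⟨ cong (λ z → EY.ev ∘ (prodMap B πY ∘ z)) (σm∘reindex σ πI v eσ) ⟩
      EY.ev ∘ (prodMap B πY ∘ (prodMap B v ∘ σm σ))        ≡⟨ cong (EY.ev ∘_) (pullˡ _ (prodMap-∘ B πY v)) ⟩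
      EY.ev ∘ (prodMap B (πY ∘ v) ∘ σm σ)                  ∎
      where
        x : Hom (σA σ) (Pb ΠE.q mV)
        x = topPoint v w ew σ eσ
        r : Hom (σA σ) (σA πI)
        r = reindex σ πI v eσ

    topOf-natural : ∀ {K K'} (v : Hom K V) (w : Hom (K ⊗ B) ΠE.P) .(ew : ΠE.q ∘ w ≡ prodMap B v)
                    (σ : Hom K I) .(eσ : πI ∘ v ≡ σ) (τ : Hom K' K)
                    (v' : Hom K' V) (w' : Hom (K' ⊗ B) ΠE.P) .(ew' : ΠE.q ∘ w' ≡ prodMap B v')
                    (σ' : Hom K' I) .(eσ' : πI ∘ v' ≡ σ') →
                    v ∘ τ ≡ v' → w ∘ prodMap B τ ≡ w' → .(eστ : σ ∘ τ ≡ σ') →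
                    topOf v' w' ew' σ' eσ' ≡ topOf v w ew σ eσ ∘ reindex σ' σ τ eστ
    topOf-natural v w ew σ eσ τ v' w' ew' σ' eσ' evv eww eστ = sym (begin
      (EP.p₁ ∘ (ΠE.ε ∘ x)) ∘ r   ≡⟨ assoc _ _ _ ⟩
      EP.p₁ ∘ ((ΠE.ε ∘ x) ∘ r)   ≡⟨ cong (EP.p₁ ∘_) (assoc _ _ _) ⟩
      EP.p₁ ∘ (ΠE.ε ∘ (x ∘ r))   ≡⟨ cong (λ z → EP.p₁ ∘ (ΠE.ε ∘ z)) xr ⟩
      EP.p₁ ∘ (ΠE.ε ∘ x')        ∎)
      where
        x : Hom (σA σ) (Pb ΠE.q mV)
        x = topPoint v w ew σ eσ
        x' : Hom (σA σ') (Pb ΠE.q mV)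
        x' = topPoint v' w' ew' σ' eσ'
        r : Hom (σA σ') (σA σ)
        r = reindex σ' σ τ eστ
        eσvτ : πI ∘ (v ∘ τ) ≡ σ'
        eσvτ = trans (sym (assoc _ _ _)) (trans (cong (_∘ τ) (unsquash eσ)) (unsquash eστ))
        xr : x ∘ r ≡ x'
        xr = PM.uniq _ _
          (begin
            PM.p₁ ∘ (x ∘ r)            ≡⟨ pullˡ _ PM.β₁ ⟩
            (w ∘ σm σ) ∘ r             ≡⟨ assoc _ _ _ ⟩
            w ∘ (σm σ ∘ r)             ≡⟨ cong (w ∘_) (σm∘reindex σ' σ τ eστ) ⟩
            w ∘ (prodMap B τ ∘ σm σ')  ≡⟨ pullˡ _ eww ⟩
            w' ∘ σm σ'                 ≡⟨ sym PM.β₁ ⟩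
            PM.p₁ ∘ x'                 ∎)
          (begin
            PM.p₂ ∘ (x ∘ r)            ≡⟨ pullˡ _ PM.β₂ ⟩
            reindex σ πI v eσ ∘ r      ≡⟨ reindex-∘ σ' σ πI v τ eσ eστ eσvτ ⟩
            reindex σ' πI (v ∘ τ) eσvτ ≡⟨ reindex-cong σ' πI eσvτ eσ' evv ⟩
            reindex σ' πI v' eσ'       ≡⟨ sym PM.β₂ ⟩
            PM.p₂ ∘ x'                 ∎)

    prob-top : ∀ {K} (u : Hom K Prob) → Hom (σA (prob-σ ∘ u)) X
    prob-top u = topOf (prob-V ∘ u) (sectionOf u) (q∘sectionOf u) (prob-σ ∘ u) (sym (assoc _ _ _))

    prob-commutes : ∀ {K} (u : Hom K Prob) →
                    f ∘ prob-top u ≡ EY.ev ∘ (prodMap B (prob-γ ∘ u) ∘ σm (prob-σ ∘ u))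
    prob-commutes u = trans (topOf-commutes (prob-V ∘ u) (sectionOf u) (q∘sectionOf u) (prob-σ ∘ u) (sym (assoc _ _ _)))
      (cong (λ z → EY.ev ∘ (prodMap B z ∘ σm (prob-σ ∘ u))) (sym (assoc _ _ _)))

    prob-top-∘ : ∀ {K K'} (u : Hom K Prob) (τ : Hom K' K) →
                 prob-top (u ∘ τ) ≡ prob-top u ∘ reindex (prob-σ ∘ (u ∘ τ)) (prob-σ ∘ u) τ (assoc _ _ _)
    prob-top-∘ u τ = topOf-natural (prob-V ∘ u) (sectionOf u) (q∘sectionOf u) (prob-σ ∘ u) (sym (assoc _ _ _)) τ
      (prob-V ∘ (u ∘ τ)) (sectionOf (u ∘ τ)) (q∘sectionOf (u ∘ τ)) (prob-σ ∘ (u ∘ τ)) (sym (assoc _ _ _))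
      (assoc _ _ _)
      (begin
        (EM.ev ∘ prodMap B (ProbP.p₁ ∘ u)) ∘ prodMap B τ   ≡⟨ assoc _ _ _ ⟩
        EM.ev ∘ (prodMap B (ProbP.p₁ ∘ u) ∘ prodMap B τ)   ≡⟨ cong (EM.ev ∘_) (prodMap-∘≡ B (assoc _ _ _)) ⟩
        EM.ev ∘ prodMap B (ProbP.p₁ ∘ (u ∘ τ))             ∎)
      (assoc _ _ _)

    prob-topAt : ∀ {K} (u : Hom K Prob) (σ : Hom K I) .(e : prob-σ ∘ u ≡ σ) → Hom (σA σ) X
    prob-topAt u σ e = prob-top u ∘ reindex σ (prob-σ ∘ u) id (trans (idʳ _) e)

    prob-topAt-cong : ∀ {K} {u u' : Hom K Prob} (σ : Hom K I)
                      .(e : prob-σ ∘ u ≡ σ) .(e' : prob-σ ∘ u' ≡ σ) →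
                      u ≡ u' → prob-topAt u σ e ≡ prob-topAt u' σ e'
    prob-topAt-cong σ e e' refl = refl

    prob-topAt-self : ∀ {K} (u : Hom K Prob) → prob-topAt u (prob-σ ∘ u) refl ≡ prob-top u
    prob-topAt-self u = trans (cong (prob-top u ∘_) (reindex-id (prob-σ ∘ u) (idʳ _))) (idʳ _)

    module Classify {K : Obj} (σ : Hom K I) (γ : Hom K Y^B) (a : Hom (σA σ) X)
                    .(commutes : f ∘ a ≡ EY.ev ∘ (prodMap B γ ∘ σm σ)) where
      v : Hom K V
      v = pair σ γ

      -- σ*(m) is also the pullback of the generic mV along v × B; toσA and fromσA
      -- are the two sides of this isomorphism.
      module Pv = Pullback (pullback (prodMap B v) mV)
      module Pσ = Pullback (pullback m (prodMap B σ))

      toσA : Hom Pv.P (σA σ)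
      toσA = Pσ.⟨ σp πI ∘ Pv.p₂ , Pv.p₁ ⟩ (begin
        m ∘ (σp πI ∘ Pv.p₂)                     ≡⟨ pullˡ _ Pσ'.comm ⟩
        (prodMap B πI ∘ mV) ∘ Pv.p₂             ≡⟨ assoc _ _ _ ⟩
        prodMap B πI ∘ (mV ∘ Pv.p₂)             ≡⟨ cong (prodMap B πI ∘_) (sym Pv.comm) ⟩
        prodMap B πI ∘ (prodMap B v ∘ Pv.p₁)    ≡⟨ pullˡ _ (prodMap-∘≡ B π₁∘pair) ⟩
        prodMap B σ ∘ Pv.p₁                     ∎)
        where module Pσ' = Pullback (pullback m (prodMap B πI))

      fromσA : Hom (σA σ) Pv.P
      fromσA = Pv.⟨ σm σ , reindex σ πI v π₁∘pair ⟩ (sym (σm∘reindex σ πI v π₁∘pair))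

      toσA∘fromσA : toσA ∘ fromσA ≡ id
      toσA∘fromσA = σA-ext σ _ _
        (begin
          σp σ ∘ (toσA ∘ fromσA)               ≡⟨ pullˡ _ Pσ.β₁ ⟩
          (σp πI ∘ Pv.p₂) ∘ fromσA             ≡⟨ assoc _ _ _ ⟩
          σp πI ∘ (Pv.p₂ ∘ fromσA)             ≡⟨ cong (σp πI ∘_) Pv.β₂ ⟩
          σp πI ∘ reindex σ πI v π₁∘pair       ≡⟨ σp∘reindex σ πI v π₁∘pair ⟩
          σp σ                                 ≡⟨ sym (idʳ _) ⟩
          σp σ ∘ id                            ∎)
        (begin
          σm σ ∘ (toσA ∘ fromσA)               ≡⟨ pullˡ _ Pσ.β₂ ⟩
          Pv.p₁ ∘ fromσA                       ≡⟨ Pv.β₁ ⟩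
          σm σ                                 ≡⟨ sym (idʳ _) ⟩
          σm σ ∘ id                            ∎)

      fromσA∘toσA : fromσA ∘ toσA ≡ id
      fromσA∘toσA = Pv.uniq _ _
        (begin
          Pv.p₁ ∘ (fromσA ∘ toσA)              ≡⟨ pullˡ _ Pv.β₁ ⟩
          σm σ ∘ toσA                          ≡⟨ Pσ.β₂ ⟩
          Pv.p₁                                ≡⟨ sym (idʳ _) ⟩
          Pv.p₁ ∘ id                           ∎)
        (begin
          Pv.p₂ ∘ (fromσA ∘ toσA)              ≡⟨ pullˡ _ Pv.β₂ ⟩
          reindex σ πI v π₁∘pair ∘ toσA        ≡⟨ σA-ext πI _ _
              (trans (pullˡ _ (σp∘reindex σ πI v π₁∘pair)) Pσ.β₁)
              (trans (pullˡ _ (σm∘reindex σ πI v π₁∘pair))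
                (trans (assoc _ _ _) (trans (cong (prodMap B v ∘_) Pσ.β₂) Pv.comm))) ⟩
          Pv.p₂                                ≡⟨ sym (idʳ _) ⟩
          Pv.p₂ ∘ id                           ∎)

      topE : Hom Pv.P EP.P
      topE = EP.⟨ a ∘ toσA , Pv.p₂ ⟩ (begin
        f ∘ (a ∘ toσA)                                    ≡⟨ pullˡ _ (unsquash commutes) ⟩
        (EY.ev ∘ (prodMap B γ ∘ σm σ)) ∘ toσA             ≡⟨ trans (assoc _ _ _) (cong (EY.ev ∘_) (assoc _ _ _)) ⟩
        EY.ev ∘ (prodMap B γ ∘ (σm σ ∘ toσA))             ≡⟨ cong (λ z → EY.ev ∘ (prodMap B γ ∘ z)) Pσ.β₂ ⟩
        EY.ev ∘ (prodMap B γ ∘ Pv.p₁)                     ≡⟨ cong (λ z → EY.ev ∘ (z ∘ Pv.p₁)) (sym (prodMap-∘≡ B π₂∘pair)) ⟩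
        EY.ev ∘ ((prodMap B πY ∘ prodMap B v) ∘ Pv.p₁)    ≡⟨ cong (EY.ev ∘_) (assoc _ _ _) ⟩
        EY.ev ∘ (prodMap B πY ∘ (prodMap B v ∘ Pv.p₁))    ≡⟨ cong (λ z → EY.ev ∘ (prodMap B πY ∘ z)) Pv.comm ⟩
        EY.ev ∘ (prodMap B πY ∘ (mV ∘ Pv.p₂))             ≡⟨ trans (cong (EY.ev ∘_) (sym (assoc _ _ _))) (sym (assoc _ _ _)) ⟩
        bottomV ∘ Pv.p₂                                   ∎)

      w : Hom (K ⊗ B) ΠE.P
      w = proj₁ (ΠE.univ (prodMap B v) topE EP.β₂)

      q∘w : ΠE.q ∘ w ≡ prodMap B v
      q∘w = proj₁ (proj₂ (ΠE.univ (prodMap B v) topE EP.β₂))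

      ε∘w : ΠE.ε ∘ fstar mV ΠE.q (prodMap B v) w q∘w ≡ topE
      ε∘w = proj₁ (proj₂ (proj₂ (ΠE.univ (prodMap B v) topE EP.β₂)))

      w-unique : ∀ (w' : Hom (K ⊗ B) ΠE.P) (e : ΠE.q ∘ w' ≡ prodMap B v) →
                 ΠE.ε ∘ fstar mV ΠE.q (prodMap B v) w' e ≡ topE → w' ≡ w
      w-unique = proj₂ (proj₂ (proj₂ (ΠE.univ (prodMap B v) topE EP.β₂)))

      classify : Hom K Prob
      classify = ProbP.⟨ EM.curry w , v ⟩ (trans (expMap∘curry B ΠE.q w) (trans (EVB.curry-cong q∘w)
                   (sym (trans (EVB.curry∘ _ _) (EVB.curry-cong (idˡ _))))))

      prob-σ∘classify : prob-σ ∘ classify ≡ σ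
      prob-σ∘classify = trans (assoc _ _ _) (trans (cong (πI ∘_) ProbP.β₂) π₁∘pair)

      prob-γ∘classify : prob-γ ∘ classify ≡ γ
      prob-γ∘classify = trans (assoc _ _ _) (trans (cong (πY ∘_) ProbP.β₂) π₂∘pair)

      sectionOf-classify : sectionOf classify ≡ w
      sectionOf-classify = trans (cong (λ z → EM.ev ∘ prodMap B z) ProbP.β₁) (EM.β w)

      topOf-fromσA : ∀ (w' : Hom (K ⊗ B) ΠE.P) (e : ΠE.q ∘ w' ≡ prodMap B v) →
                     topOf v w' e σ π₁∘pair ≡ (EP.p₁ ∘ (ΠE.ε ∘ fstar mV ΠE.q (prodMap B v) w' e)) ∘ fromσA
      topOf-fromσA w' e = begin
        EP.p₁ ∘ (ΠE.ε ∘ topPoint v w' e σ π₁∘pair)  ≡⟨ cong (λ z → EP.p₁ ∘ (ΠE.ε ∘ z)) point ⟩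
        EP.p₁ ∘ (ΠE.ε ∘ (fs ∘ fromσA))              ≡⟨ cong (EP.p₁ ∘_) (sym (assoc _ _ _)) ⟩
        EP.p₁ ∘ ((ΠE.ε ∘ fs) ∘ fromσA)              ≡⟨ sym (assoc _ _ _) ⟩
        (EP.p₁ ∘ (ΠE.ε ∘ fs)) ∘ fromσA              ∎
        where
          fs : Hom Pv.P (Pb ΠE.q mV)
          fs = fstar mV ΠE.q (prodMap B v) w' e
          point : topPoint v w' e σ π₁∘pair ≡ fs ∘ fromσA
          point = PM.uniq _ _
            (trans PM.β₁ (sym (trans (pullˡ _ PM.β₁) (trans (assoc _ _ _) (cong (w' ∘_) Pv.β₁)))))
            (trans PM.β₂ (sym (trans (pullˡ _ PM.β₂) Pv.β₂)))

      topOf-w : topOf v w q∘w σ π₁∘pair ≡ a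
      topOf-w = begin
        topOf v w q∘w σ π₁∘pair                                   ≡⟨ topOf-fromσA w q∘w ⟩
        (EP.p₁ ∘ (ΠE.ε ∘ fstar mV ΠE.q (prodMap B v) w q∘w)) ∘ fromσA ≡⟨ cong (λ z → (EP.p₁ ∘ z) ∘ fromσA) ε∘w ⟩
        (EP.p₁ ∘ topE) ∘ fromσA                                   ≡⟨ cong (_∘ fromσA) EP.β₁ ⟩
        (a ∘ toσA) ∘ fromσA                                       ≡⟨ assoc _ _ _ ⟩
        a ∘ (toσA ∘ fromσA)                                       ≡⟨ cong (a ∘_) toσA∘fromσA ⟩
        a ∘ id                                                    ≡⟨ idʳ _ ⟩
        a                                                         ∎

      topOf-prob-topAt : ∀ (u : Hom K Prob) (eu : prob-V ∘ u ≡ v) .(eσ : prob-σ ∘ u ≡ σ) →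
                         topOf v (sectionOf u) (trans (q∘sectionOf u) (prodMap-cong B eu)) σ π₁∘pair
                           ≡ prob-topAt u σ eσ
      topOf-prob-topAt u eu eσ = topOf-natural (prob-V ∘ u) (sectionOf u) (q∘sectionOf u) (prob-σ ∘ u)
        (sym (assoc _ _ _)) id v (sectionOf u) (trans (q∘sectionOf u) (prodMap-cong B eu)) σ π₁∘pair (trans (idʳ _) eu)
        (trans (cong (sectionOf u ∘_) (prodMap-id B)) (idʳ _)) (trans (idʳ _) eσ)

      prob-topAt-classify : prob-topAt classify σ prob-σ∘classify ≡ a
      prob-topAt-classify = begin
        prob-topAt classify σ prob-σ∘classify                         ≡⟨ sym (topOf-prob-topAt classify ProbP.β₂ prob-σ∘classify) ⟩
        topOf v (sectionOf classify) e σ π₁∘pair                      ≡⟨ topOf-cong sectionOf-classify ⟩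
        topOf v w q∘w σ π₁∘pair                                       ≡⟨ topOf-w ⟩
        a                                                             ∎
        where
          e : ΠE.q ∘ sectionOf classify ≡ prodMap B v
          e = trans (q∘sectionOf classify) (prodMap-cong B ProbP.β₂)
          topOf-cong : ∀ {w'} (ew' : w' ≡ w) → topOf v w' (trans (cong (ΠE.q ∘_) ew') q∘w) σ π₁∘pair
                                                 ≡ topOf v w q∘w σ π₁∘pair
          topOf-cong refl = refl

      classify-unique : (u : Hom K Prob) .(eσ : prob-σ ∘ u ≡ σ) → prob-γ ∘ u ≡ γ →
                        prob-topAt u σ eσ ≡ a → u ≡ classify
      classify-unique u eσ eγ ea = ProbP.uniq _ _ p₁-eq (trans eu (sym ProbP.β₂))
        where
          eu : prob-V ∘ u ≡ v
          eu = pair-unique _ (trans (sym (assoc _ _ _)) (unsquash eσ)) (trans (sym (assoc _ _ _)) eγ)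
          e' : ΠE.q ∘ sectionOf u ≡ prodMap B v
          e' = trans (q∘sectionOf u) (prodMap-cong B eu)
          fs : Hom Pv.P (Pb ΠE.q mV)
          fs = fstar mV ΠE.q (prodMap B v) (sectionOf u) e'
          top : Hom Pv.P X
          top = EP.p₁ ∘ (ΠE.ε ∘ fs)
          top-eq : top ≡ a ∘ toσA
          top-eq = begin
            top                        ≡⟨ sym (idʳ _) ⟩
            top ∘ id                   ≡⟨ cong (top ∘_) (sym fromσA∘toσA) ⟩
            top ∘ (fromσA ∘ toσA)      ≡⟨ sym (assoc _ _ _) ⟩
            (top ∘ fromσA) ∘ toσA      ≡⟨ cong (_∘ toσA) (sym (topOf-fromσA (sectionOf u) e')) ⟩
            topOf v (sectionOf u) e' σ π₁∘pair ∘ toσA ≡⟨ cong (_∘ toσA) (trans (topOf-prob-topAt u eu eσ) ea) ⟩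
            a ∘ toσA                   ∎
          ε-eq : ΠE.ε ∘ fs ≡ topE
          ε-eq = EP.uniq _ _ (trans top-eq (sym EP.β₁))
                   (trans (pullˡ _ ΠE.ε-over) (trans PM.β₂ (sym EP.β₂)))
          p₁-eq : ProbP.p₁ ∘ u ≡ ProbP.p₁ ∘ classify
          p₁-eq = trans (sym (EM.curry-ev _))
                    (trans (EM.curry-cong (w-unique (sectionOf u) e' ε-eq)) (sym ProbP.β₁))

    open Classify public
      using (classify; prob-σ∘classify; prob-γ∘classify; prob-topAt-classify; classify-unique)

    classify-cong : ∀ {K} (σ : Hom K I) {γ γ' : Hom K Y^B} {a a' : Hom (σA σ) X}
                    .(c : f ∘ a ≡ EY.ev ∘ (prodMap B γ ∘ σm σ))
                    .(c' : f ∘ a' ≡ EY.ev ∘ (prodMap B γ' ∘ σm σ)) →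
                    γ ≡ γ' → a ≡ a' → classify σ γ a c ≡ classify σ γ' a' c'
    classify-cong σ c c' refl refl = refl

    prob-topAt-∘ : ∀ {K K'} (u : Hom K Prob) (τ : Hom K' K) (σ : Hom K I) (σ' : Hom K' I)
                   .(e : prob-σ ∘ u ≡ σ) .(e' : prob-σ ∘ (u ∘ τ) ≡ σ') .(e'' : σ ∘ τ ≡ σ') →
                   prob-topAt (u ∘ τ) σ' e' ≡ prob-topAt u σ e ∘ reindex σ' σ τ e''
    prob-topAt-∘ {K} {K'} u τ σ σ' e e' e'' = begin
      prob-top (u ∘ τ) ∘ reindex σ' σuτ id e'₀
        ≡⟨ cong (_∘ reindex σ' σuτ id e'₀) (prob-top-∘ u τ) ⟩
      (prob-top u ∘ reindex σuτ σu τ (assoc _ _ _)) ∘ reindex σ' σuτ id e'₀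
        ≡⟨ assoc _ _ _ ⟩
      prob-top u ∘ (reindex σuτ σu τ (assoc _ _ _) ∘ reindex σ' σuτ id e'₀)
        ≡⟨ cong (prob-top u ∘_) (reindex-∘ σ' σuτ σu τ id (assoc _ _ _) e'₀ eτid) ⟩
      prob-top u ∘ reindex σ' σu (τ ∘ id) eτid
        ≡⟨ cong (prob-top u ∘_) (reindex-cong σ' σu eτid eidτ (trans (idʳ _) (sym (idˡ _)))) ⟩
      prob-top u ∘ reindex σ' σu (id ∘ τ) eidτ
        ≡⟨ cong (prob-top u ∘_) (sym (reindex-∘ σ' σ σu id τ (trans (idʳ _) e) e'' eidτ)) ⟩
      prob-top u ∘ (reindex σ σu id (trans (idʳ _) e) ∘ reindex σ' σ τ e'')
        ≡⟨ sym (assoc _ _ _) ⟩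
      prob-topAt u σ e ∘ reindex σ' σ τ e'' ∎
      where
        σu : Hom K I
        σu = prob-σ ∘ u
        σuτ : Hom K' I
        σuτ = prob-σ ∘ (u ∘ τ)
        e'₀ : σuτ ∘ id ≡ σ'
        e'₀ = trans (idʳ _) (unsquash e')
        eτid : σu ∘ (τ ∘ id) ≡ σ'
        eτid = trans (cong (σu ∘_) (idʳ _)) (trans (assoc _ _ _) (unsquash e'))
        eidτ : σu ∘ (id ∘ τ) ≡ σ'
        eidτ = trans (sym (assoc _ _ _)) (trans (cong (_∘ τ) (trans (idʳ _) (unsquash e))) (unsquash e''))

    prob-topAt-commutes : ∀ {K} (u : Hom K Prob) (σ : Hom K I) .(e : prob-σ ∘ u ≡ σ) →
                          f ∘ prob-topAt u σ e ≡ EY.ev ∘ (prodMap B (prob-γ ∘ u) ∘ σm σ)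
    prob-topAt-commutes {K} u σ e = begin
      f ∘ (prob-top u ∘ r)                                ≡⟨ pullˡ _ (prob-commutes u) ⟩
      (EY.ev ∘ (prodMap B γu ∘ σm (prob-σ ∘ u))) ∘ r      ≡⟨ trans (assoc _ _ _) (cong (EY.ev ∘_) (assoc _ _ _)) ⟩
      EY.ev ∘ (prodMap B γu ∘ (σm (prob-σ ∘ u) ∘ r))      ≡⟨ cong (λ z → EY.ev ∘ (prodMap B γu ∘ z)) σm∘r ⟩
      EY.ev ∘ (prodMap B γu ∘ σm σ)                       ∎
      where
        r : Hom (σA σ) (σA (prob-σ ∘ u))
        r = reindex σ (prob-σ ∘ u) id (trans (idʳ _) e)
        γu : Hom K Y^B
        γu = prob-γ ∘ u
        σm∘r : σm (prob-σ ∘ u) ∘ r ≡ σm σ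
        σm∘r = trans (σm∘reindex σ (prob-σ ∘ u) id (trans (idʳ _) e))
                 (trans (cong (_∘ σm σ) (prodMap-id B)) (idˡ _))

    Prob-ext : ∀ {K} (u u' : Hom K Prob) (σ : Hom K I) (e : prob-σ ∘ u ≡ σ) (e' : prob-σ ∘ u' ≡ σ) →
               prob-γ ∘ u ≡ prob-γ ∘ u' → prob-topAt u σ e ≡ prob-topAt u' σ e' → u ≡ u'
    Prob-ext u u' σ e e' eγ ea =
      trans (classify-unique σ (prob-γ ∘ u) (prob-topAt u σ e) c u e refl refl)
            (sym (classify-unique σ (prob-γ ∘ u) (prob-topAt u σ e) c u' e' (sym eγ) (sym ea)))
      where c = prob-topAt-commutes u σ e

  module LiftStrClassifier (Lc : LCCCStr) (B I A : Obj) (m : Hom A (I ⊗ B)) {X Y : Obj} (f : Hom X Y) where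
    open LCCCStr Lc
    open ExponentialFacts Lc
    open ReindexingFacts I B A m
    open Lifting I B A m
    open Problems Lc B I A m f

    Ω : Obj
    Ω = I ⊗ X^B

    ωσ : Hom Ω I
    ωσ = π₁

    ωδ : Hom Ω X^B
    ωδ = π₂

    filledTop : Hom (σA ωσ) X
    filledTop = EX.ev ∘ (prodMap B ωδ ∘ σm ωσ)

    filled-commutes : f ∘ filledTop ≡ EY.ev ∘ (prodMap B (f^B ∘ ωδ) ∘ σm ωσ)
    filled-commutes = begin
      f ∘ (EX.ev ∘ (prodMap B ωδ ∘ σm ωσ))       ≡⟨ trans (sym (assoc _ _ _)) (sym (assoc _ _ _)) ⟩
      ((f ∘ EX.ev) ∘ prodMap B ωδ) ∘ σm ωσ       ≡⟨ cong (_∘ σm ωσ) (trans (assoc _ _ _) (sym (ev∘expMap B f ωδ))) ⟩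
      (EY.ev ∘ prodMap B (f^B ∘ ωδ)) ∘ σm ωσ     ≡⟨ assoc _ _ _ ⟩
      EY.ev ∘ (prodMap B (f^B ∘ ωδ) ∘ σm ωσ)     ∎

    filled : Hom Ω Prob
    filled = classify ωσ (f^B ∘ ωδ) filledTop filled-commutes

    prob-σ∘filled : prob-σ ∘ filled ≡ ωσ
    prob-σ∘filled = prob-σ∘classify ωσ (f^B ∘ ωδ) filledTop filled-commutes

    prob-σ∘filled∘ : ∀ {K} (x : Hom K Ω) → prob-σ ∘ (filled ∘ x) ≡ ωσ ∘ x
    prob-σ∘filled∘ x = pullˡ x prob-σ∘filled

    prob-γ∘filled∘ : ∀ {K} (x : Hom K Ω) → prob-γ ∘ (filled ∘ x) ≡ f^B ∘ (ωδ ∘ x)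
    prob-γ∘filled∘ x = trans (pullˡ x (prob-γ∘classify ωσ (f^B ∘ ωδ) filledTop filled-commutes)) (assoc _ _ _)

    prob-topAt-filled : ∀ {K} (x : Hom K Ω) (σ : Hom K I) (eσ : ωσ ∘ x ≡ σ) .(e : prob-σ ∘ (filled ∘ x) ≡ σ) →
                        prob-topAt (filled ∘ x) σ e ≡ EX.ev ∘ (prodMap B (ωδ ∘ x) ∘ σm σ)
    prob-topAt-filled x σ eσ e = begin
      prob-topAt (filled ∘ x) σ e
        ≡⟨ prob-topAt-∘ filled x ωσ σ prob-σ∘filled e eσ ⟩
      prob-topAt filled ωσ prob-σ∘filled ∘ reindex σ ωσ x eσ
        ≡⟨ cong (_∘ reindex σ ωσ x eσ) (prob-topAt-classify ωσ (f^B ∘ ωδ) filledTop filled-commutes) ⟩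
      filledTop ∘ reindex σ ωσ x eσ
        ≡⟨ trans (assoc _ _ _) (cong (EX.ev ∘_) (assoc _ _ _)) ⟩
      EX.ev ∘ (prodMap B ωδ ∘ (σm ωσ ∘ reindex σ ωσ x eσ))
        ≡⟨ cong (λ z → EX.ev ∘ (prodMap B ωδ ∘ z)) (σm∘reindex σ ωσ x eσ) ⟩
      EX.ev ∘ (prodMap B ωδ ∘ (prodMap B x ∘ σm σ))
        ≡⟨ cong (EX.ev ∘_) (pullˡ _ (prodMap-∘ B ωδ x)) ⟩
      EX.ev ∘ (prodMap B (ωδ ∘ x) ∘ σm σ) ∎

    -- A map into W over Y^B chooses a filler for every problem with the given bottom edge.
    module ΠW = DepProd (Π prob-γ filled)
    module PW = Pullback (pullback ΠW.q prob-γ)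

    module Over {Z : Obj} (g : Hom Z Y) where
      module EZ = Exp B Z
      module PF = Pullback (pullback f g)

      Z^B : Obj
      Z^B = EZ.E

      g^B : Hom Z^B Y^B
      g^B = expMap Lc B g

      ev∘g^B : ∀ {K} (b : Hom (K ⊗ B) Z) → EY.ev ∘ prodMap B (g^B ∘ EZ.curry b) ≡ g ∘ b
      ev∘g^B b = trans (ev∘expMap B g (EZ.curry b)) (cong (g ∘_) (EZ.β b))

      square-commutes : ∀ {K} (σ : Hom K I) (a : Hom (σA σ) PF.P) (b : Hom (K ⊗ B) Z) →
                        .(PF.p₂ ∘ a ≡ b ∘ σm σ) →
                        f ∘ (PF.p₁ ∘ a) ≡ EY.ev ∘ (prodMap B (g^B ∘ EZ.curry b) ∘ σm σ)
      square-commutes σ a b e = begin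
        f ∘ (PF.p₁ ∘ a)                                    ≡⟨ PullbackFacts.comm∘ (pullback f g) a ⟩
        g ∘ (PF.p₂ ∘ a)                                    ≡⟨ cong (g ∘_) (unsquash e) ⟩
        g ∘ (b ∘ σm σ)                                     ≡⟨ sym (assoc _ _ _) ⟩
        (g ∘ b) ∘ σm σ                                     ≡⟨ cong (_∘ σm σ) (sym (ev∘g^B b)) ⟩
        (EY.ev ∘ prodMap B (g^B ∘ EZ.curry b)) ∘ σm σ      ≡⟨ assoc _ _ _ ⟩
        EY.ev ∘ (prodMap B (g^B ∘ EZ.curry b) ∘ σm σ)      ∎

      squareProb : ∀ {K} (σ : Hom K I) (a : Hom (σA σ) PF.P) (b : Hom (K ⊗ B) Z) →
                   .(PF.p₂ ∘ a ≡ b ∘ σm σ) → Hom K Prob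
      squareProb σ a b e = classify σ (g^B ∘ EZ.curry b) (PF.p₁ ∘ a) (square-commutes σ a b e)

      prob-σ∘squareProb : ∀ {K} (σ : Hom K I) (a : Hom (σA σ) PF.P) (b : Hom (K ⊗ B) Z)
                          .(e : PF.p₂ ∘ a ≡ b ∘ σm σ) → prob-σ ∘ squareProb σ a b e ≡ σ
      prob-σ∘squareProb σ a b e = prob-σ∘classify _ _ _ (square-commutes σ a b e)

      prob-γ∘squareProb : ∀ {K} (σ : Hom K I) (a : Hom (σA σ) PF.P) (b : Hom (K ⊗ B) Z)
                          .(e : PF.p₂ ∘ a ≡ b ∘ σm σ) → prob-γ ∘ squareProb σ a b e ≡ g^B ∘ EZ.curry b
      prob-γ∘squareProb σ a b e = prob-γ∘classify _ _ _ (square-commutes σ a b e)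

      prob-topAt-squareProb : ∀ {K} (σ : Hom K I) (a : Hom (σA σ) PF.P) (b : Hom (K ⊗ B) Z)
                              .(e : PF.p₂ ∘ a ≡ b ∘ σm σ) .(e' : prob-σ ∘ squareProb σ a b e ≡ σ) →
                              prob-topAt (squareProb σ a b e) σ e' ≡ PF.p₁ ∘ a
      prob-topAt-squareProb σ a b e e' = prob-topAt-classify _ _ _ (square-commutes σ a b e)

      squareProb-∘ : ∀ {K K'} (σ : Hom K I) (τ : Hom K' K) (a : Hom (σA σ) PF.P) (b : Hom (K ⊗ B) Z)
                     (e : PF.p₂ ∘ a ≡ b ∘ σm σ) →
                     squareProb σ a b e ∘ τ
                       ≡ squareProb (σ ∘ τ) (a ∘ reTop σ τ) (b ∘ prodMap B τ) (reSq PF.p₂ σ τ a b e)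
      squareProb-∘ σ τ a b e = classify-unique _ _ _ (square-commutes _ _ _ (reSq PF.p₂ σ τ a b e)) (u ∘ τ)
        (pullˡ τ (prob-σ∘squareProb σ a b e))
        (trans (pullˡ τ (prob-γ∘squareProb σ a b e)) (trans (assoc _ _ _) (cong (g^B ∘_) (EZ.curry∘ b τ))))
        (trans (prob-topAt-∘ u τ σ (σ ∘ τ) (prob-σ∘squareProb σ a b e) (pullˡ τ (prob-σ∘squareProb σ a b e)) refl)
               (trans (cong (_∘ reTop σ τ) (prob-topAt-squareProb σ a b e (prob-σ∘squareProb σ a b e))) (assoc _ _ _)))
        where u = squareProb σ a b e

      module LiftStrOf (k : Hom Z^B ΠW.P) (ek : ΠW.q ∘ k ≡ g^B) where
        fillerPoint : ∀ {K} (σ : Hom K I) (a : Hom (σA σ) PF.P) (b : Hom (K ⊗ B) Z) →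
                      .(PF.p₂ ∘ a ≡ b ∘ σm σ) → Hom K (Pb ΠW.q prob-γ)
        fillerPoint σ a b e = PW.⟨ k ∘ EZ.curry b , squareProb σ a b e ⟩
          (trans (pullˡ _ ek) (sym (prob-γ∘squareProb σ a b e)))

        filled∘fillerPoint : ∀ {K} (σ : Hom K I) (a : Hom (σA σ) PF.P) (b : Hom (K ⊗ B) Z)
                             .(e : PF.p₂ ∘ a ≡ b ∘ σm σ) →
                             filled ∘ (ΠW.ε ∘ fillerPoint σ a b e) ≡ squareProb σ a b e
        filled∘fillerPoint σ a b e = trans (pullˡ _ ΠW.ε-over) PW.β₂

        filler : ∀ {K} (σ : Hom K I) (a : Hom (σA σ) PF.P) (b : Hom (K ⊗ B) Z) →
                 .(PF.p₂ ∘ a ≡ b ∘ σm σ) → Hom (K ⊗ B) X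
        filler σ a b e = EX.ev ∘ prodMap B (ωδ ∘ (ΠW.ε ∘ fillerPoint σ a b e))

        f∘filler : ∀ {K} (σ : Hom K I) (a : Hom (σA σ) PF.P) (b : Hom (K ⊗ B) Z)
                   .(e : PF.p₂ ∘ a ≡ b ∘ σm σ) → f ∘ filler σ a b e ≡ g ∘ b
        f∘filler {K} σ a b e = begin
          f ∘ (EX.ev ∘ prodMap B δ)           ≡⟨ sym (ev∘expMap B f δ) ⟩
          EY.ev ∘ prodMap B (f^B ∘ δ)         ≡⟨ cong (λ z → EY.ev ∘ prodMap B z) f^B∘δ ⟩
          EY.ev ∘ prodMap B (g^B ∘ EZ.curry b) ≡⟨ ev∘g^B b ⟩
          g ∘ b                               ∎
          where
            δ : Hom K X^B
            δ = ωδ ∘ (ΠW.ε ∘ fillerPoint σ a b e)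
            f^B∘δ : f^B ∘ δ ≡ g^B ∘ EZ.curry b
            f^B∘δ = trans (sym (prob-γ∘filled∘ _))
                      (trans (cong (prob-γ ∘_) (filled∘fillerPoint σ a b e)) (prob-γ∘squareProb σ a b e))

        fillₖ : ∀ {K} (σ : Hom K I) (a : Hom (σA σ) PF.P) (b : Hom (K ⊗ B) Z) →
                .(PF.p₂ ∘ a ≡ b ∘ σm σ) → Hom (K ⊗ B) PF.P
        fillₖ σ a b e = PF.⟨ filler σ a b e , b ⟩ (f∘filler σ a b e)

        fillₖ-up : ∀ {K} (σ : Hom K I) (a : Hom (σA σ) PF.P) (b : Hom (K ⊗ B) Z)
                   .(e : PF.p₂ ∘ a ≡ b ∘ σm σ) → fillₖ σ a b e ∘ σm σ ≡ a
        fillₖ-up {K} σ a b e = PF.uniq _ _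
          (begin
            PF.p₁ ∘ (fillₖ σ a b e ∘ σm σ)         ≡⟨ pullˡ _ PF.β₁ ⟩
            filler σ a b e ∘ σm σ                  ≡⟨ assoc _ _ _ ⟩
            EX.ev ∘ (prodMap B (ωδ ∘ ω) ∘ σm σ)    ≡⟨ sym (prob-topAt-filled ω σ eσ eσ') ⟩
            prob-topAt (filled ∘ ω) σ eσ'          ≡⟨ prob-topAt-cong σ eσ' eu (filled∘fillerPoint σ a b e) ⟩
            prob-topAt (squareProb σ a b e) σ eu   ≡⟨ prob-topAt-squareProb σ a b e eu ⟩
            PF.p₁ ∘ a                              ∎)
          (trans (pullˡ _ PF.β₂) (sym (unsquash e)))
          where
            ω : Hom K Ω
            ω = ΠW.ε ∘ fillerPoint σ a b e
            eu : prob-σ ∘ squareProb σ a b e ≡ σ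
            eu = prob-σ∘squareProb σ a b e
            eσ' : prob-σ ∘ (filled ∘ ω) ≡ σ
            eσ' = trans (cong (prob-σ ∘_) (filled∘fillerPoint σ a b e)) (prob-σ∘squareProb σ a b e)
            eσ : ωσ ∘ ω ≡ σ
            eσ = trans (sym (prob-σ∘filled∘ ω)) eσ'

        fillₖ-stable : ∀ {K K'} (σ : Hom K I) (τ : Hom K' K) (a : Hom (σA σ) PF.P) (b : Hom (K ⊗ B) Z)
                       (e : PF.p₂ ∘ a ≡ b ∘ σm σ) →
                       fillₖ (σ ∘ τ) (a ∘ reTop σ τ) (b ∘ prodMap B τ) (reSq PF.p₂ σ τ a b e)
                         ≡ fillₖ σ a b e ∘ prodMap B τ
        fillₖ-stable σ τ a b e = sym (trans (PullbackFacts.⟨⟩∘ (pullback f g) (prodMap B τ))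
          (PullbackFacts.⟨⟩-cong₂ (pullback f g) (trans (assoc _ _ _) (cong (EX.ev ∘_) filler∘)) refl))
          where
            e' : PF.p₂ ∘ (a ∘ reTop σ τ) ≡ (b ∘ prodMap B τ) ∘ σm (σ ∘ τ)
            e' = reSq PF.p₂ σ τ a b e
            point∘ : fillerPoint σ a b e ∘ τ ≡ fillerPoint (σ ∘ τ) (a ∘ reTop σ τ) (b ∘ prodMap B τ) e'
            point∘ = trans (PullbackFacts.⟨⟩∘ (pullback ΠW.q prob-γ) τ)
              (PullbackFacts.⟨⟩-cong₂ (pullback ΠW.q prob-γ)
                (trans (assoc _ _ _) (cong (k ∘_) (EZ.curry∘ b τ))) (squareProb-∘ σ τ a b e))
            filler∘ : prodMap B (ωδ ∘ (ΠW.ε ∘ fillerPoint σ a b e)) ∘ prodMap B τ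
                        ≡ prodMap B (ωδ ∘ (ΠW.ε ∘ fillerPoint (σ ∘ τ) (a ∘ reTop σ τ) (b ∘ prodMap B τ) e'))
            filler∘ = prodMap-∘≡ B (trans (assoc _ _ _) (cong (ωδ ∘_) (trans (assoc _ _ _) (cong (ΠW.ε ∘_) point∘))))

        liftStr : LiftStr (pr₂ {f = f} {g = g})
        liftStr = record { fill = fillₖ ; up = fillₖ-up ; down = λ _ _ _ _ → PF.β₂ ; stable = fillₖ-stable }

      -- The generic square against g*(f) lives over G, the object of problems against f
      -- whose bottom edge factors through g^B; every square is reindexed from it.
      module GP = Pullback (pullback g^B prob-γ)

      G : Obj
      G = GP.P

      genσ : Hom G I
      genσ = prob-σ ∘ GP.p₂

      genBottom : Hom (G ⊗ B) Z
      genBottom = EZ.ev ∘ prodMap B GP.p₁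

      genTop : Hom (σA genσ) PF.P
      genTop = PF.⟨ prob-top GP.p₂ , genBottom ∘ σm genσ ⟩ (begin
        f ∘ prob-top GP.p₂                                  ≡⟨ prob-commutes GP.p₂ ⟩
        EY.ev ∘ (prodMap B (prob-γ ∘ GP.p₂) ∘ σm genσ)      ≡⟨ cong (λ z → EY.ev ∘ (prodMap B z ∘ σm genσ)) (sym GP.comm) ⟩
        EY.ev ∘ (prodMap B (g^B ∘ GP.p₁) ∘ σm genσ)         ≡⟨ sym (assoc _ _ _) ⟩
        (EY.ev ∘ prodMap B (g^B ∘ GP.p₁)) ∘ σm genσ         ≡⟨ cong (_∘ σm genσ) (ev∘expMap B g GP.p₁) ⟩
        (g ∘ genBottom) ∘ σm genσ                           ≡⟨ assoc _ _ _ ⟩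
        g ∘ (genBottom ∘ σm genσ)                           ∎)

      gen-commutes : PF.p₂ ∘ genTop ≡ genBottom ∘ σm genσ
      gen-commutes = PF.β₂

      module ToGeneric {K} (σ : Hom K I) (a : Hom (σA σ) PF.P) (b : Hom (K ⊗ B) Z)
                       (e : PF.p₂ ∘ a ≡ b ∘ σm σ) where
        toGeneric : Hom K G
        toGeneric = GP.⟨ EZ.curry b , squareProb σ a b e ⟩ (sym (prob-γ∘squareProb σ a b e))

        genσ∘toGeneric : genσ ∘ toGeneric ≡ σ
        genσ∘toGeneric = trans (assoc _ _ _) (trans (cong (prob-σ ∘_) GP.β₂) (prob-σ∘squareProb σ a b e))

        genBottom-toGeneric : genBottom ∘ prodMap B toGeneric ≡ b
        genBottom-toGeneric = trans (assoc _ _ _) (trans (cong (EZ.ev ∘_) (prodMap-∘≡ B GP.β₁)) (EZ.β b))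

        genTop-toGeneric : genTop ∘ reindex σ genσ toGeneric genσ∘toGeneric ≡ a
        genTop-toGeneric = PF.uniq _ _
          (begin
            PF.p₁ ∘ (genTop ∘ r)                         ≡⟨ pullˡ _ PF.β₁ ⟩
            prob-top GP.p₂ ∘ r                           ≡⟨ cong (_∘ r) (sym (prob-topAt-self GP.p₂)) ⟩
            prob-topAt GP.p₂ genσ refl ∘ r               ≡⟨ sym (prob-topAt-∘ GP.p₂ toGeneric genσ σ refl eσ genσ∘toGeneric) ⟩
            prob-topAt (GP.p₂ ∘ toGeneric) σ eσ          ≡⟨ prob-topAt-cong σ eσ eu GP.β₂ ⟩
            prob-topAt (squareProb σ a b e) σ eu         ≡⟨ prob-topAt-squareProb σ a b e eu ⟩
            PF.p₁ ∘ a                                    ∎)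
          (begin
            PF.p₂ ∘ (genTop ∘ r)                         ≡⟨ pullˡ _ PF.β₂ ⟩
            (genBottom ∘ σm genσ) ∘ r                    ≡⟨ assoc _ _ _ ⟩
            genBottom ∘ (σm genσ ∘ r)                    ≡⟨ cong (genBottom ∘_) (σm∘reindex σ genσ toGeneric genσ∘toGeneric) ⟩
            genBottom ∘ (prodMap B toGeneric ∘ σm σ)     ≡⟨ pullˡ _ genBottom-toGeneric ⟩
            b ∘ σm σ                                     ≡⟨ sym e ⟩
            PF.p₂ ∘ a                                    ∎)
          where
            r : Hom (σA σ) (σA genσ)
            r = reindex σ genσ toGeneric genσ∘toGeneric
            eσ : prob-σ ∘ (GP.p₂ ∘ toGeneric) ≡ σ
            eσ = trans (sym (assoc _ _ _)) genσ∘toGeneric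
            eu : prob-σ ∘ squareProb σ a b e ≡ σ
            eu = prob-σ∘squareProb σ a b e

      module ClassifyLiftStr (s : LiftStr (pr₂ {f = f} {g = g})) where
        open LiftStr s

        genFill : Hom (G ⊗ B) PF.P
        genFill = fill genσ genTop genBottom gen-commutes

        genFiller^B : Hom G X^B
        genFiller^B = EX.curry (PF.p₁ ∘ genFill)

        genFilled : Hom G Ω
        genFilled = pair genσ genFiller^B

        filled∘genFilled : filled ∘ genFilled ≡ GP.p₂
        filled∘genFilled = Prob-ext (filled ∘ genFilled) GP.p₂ genσ eσ refl eγ ea
          where
            eσ : prob-σ ∘ (filled ∘ genFilled) ≡ genσ
            eσ = trans (prob-σ∘filled∘ genFilled) π₁∘pair
            eγ : prob-γ ∘ (filled ∘ genFilled) ≡ prob-γ ∘ GP.p₂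
            eγ = begin
              prob-γ ∘ (filled ∘ genFilled)         ≡⟨ prob-γ∘filled∘ genFilled ⟩
              f^B ∘ (ωδ ∘ genFilled)                ≡⟨ cong (f^B ∘_) π₂∘pair ⟩
              f^B ∘ genFiller^B                     ≡⟨ expMap∘curry B f _ ⟩
              EY.curry (f ∘ (PF.p₁ ∘ genFill))      ≡⟨ EY.curry-cong (trans (PullbackFacts.comm∘ (pullback f g) genFill)
                                                         (cong (g ∘_) (down genσ genTop genBottom gen-commutes))) ⟩
              EY.curry (g ∘ genBottom)              ≡⟨ sym (expMap∘curry B g _) ⟩
              g^B ∘ EZ.curry genBottom              ≡⟨ cong (g^B ∘_) (EZ.curry-ev GP.p₁) ⟩
              g^B ∘ GP.p₁                           ≡⟨ GP.comm ⟩
              prob-γ ∘ GP.p₂                        ∎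
            ea : prob-topAt (filled ∘ genFilled) genσ eσ ≡ prob-topAt GP.p₂ genσ refl
            ea = begin
              prob-topAt (filled ∘ genFilled) genσ eσ       ≡⟨ prob-topAt-filled genFilled genσ π₁∘pair eσ ⟩
              EX.ev ∘ (prodMap B (ωδ ∘ genFilled) ∘ σm genσ) ≡⟨ cong (λ z → EX.ev ∘ (prodMap B z ∘ σm genσ)) π₂∘pair ⟩
              EX.ev ∘ (prodMap B genFiller^B ∘ σm genσ)     ≡⟨ sym (assoc _ _ _) ⟩
              (EX.ev ∘ prodMap B genFiller^B) ∘ σm genσ     ≡⟨ cong (_∘ σm genσ) (EX.β _) ⟩
              (PF.p₁ ∘ genFill) ∘ σm genσ                   ≡⟨ assoc _ _ _ ⟩
              PF.p₁ ∘ (genFill ∘ σm genσ)                   ≡⟨ cong (PF.p₁ ∘_) (up genσ genTop genBottom gen-commutes) ⟩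
              PF.p₁ ∘ genTop                                ≡⟨ PF.β₁ ⟩
              prob-top GP.p₂                                ≡⟨ sym (prob-topAt-self GP.p₂) ⟩
              prob-topAt GP.p₂ genσ refl                    ∎

        φ : Hom Z^B ΠW.P
        φ = proj₁ (ΠW.univ g^B genFilled filled∘genFilled)

        q∘φ : ΠW.q ∘ φ ≡ g^B
        q∘φ = proj₁ (proj₂ (ΠW.univ g^B genFilled filled∘genFilled))

        ε∘φ : ΠW.ε ∘ fstar prob-γ ΠW.q g^B φ q∘φ ≡ genFilled
        ε∘φ = proj₁ (proj₂ (proj₂ (ΠW.univ g^B genFilled filled∘genFilled)))

        φ-universal : ∀ (k : Hom Z^B ΠW.P) (ek : ΠW.q ∘ k ≡ g^B) →
                      ΠW.ε ∘ fstar prob-γ ΠW.q g^B k ek ≡ genFilled → k ≡ φ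
        φ-universal = proj₂ (proj₂ (proj₂ (ΠW.univ g^B genFilled filled∘genFilled)))

        fillₖ-φ : ∀ {K} (σ : Hom K I) (a : Hom (σA σ) PF.P) (b : Hom (K ⊗ B) Z)
                  (e : PF.p₂ ∘ a ≡ b ∘ σm σ) → LiftStrOf.fillₖ φ q∘φ σ a b e ≡ fill σ a b e
        fillₖ-φ σ a b e = trans fillₖ-generic (sym fill-generic)
          where
            open ToGeneric σ a b e
            fill-generic : fill σ a b e ≡ genFill ∘ prodMap B toGeneric
            fill-generic = stable-reindex s genσ toGeneric genσ∘toGeneric genTop genBottom gen-commutes
                             genTop-toGeneric genBottom-toGeneric
            fs : Hom G (Pb ΠW.q prob-γ)
            fs = fstar prob-γ ΠW.q g^B φ q∘φ
            point : LiftStrOf.fillerPoint φ q∘φ σ a b e ≡ fs ∘ toGeneric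
            point = PW.uniq _ _
              (trans PW.β₁ (sym (trans (pullˡ _ PW.β₁) (trans (assoc _ _ _) (cong (φ ∘_) GP.β₁)))))
              (trans PW.β₂ (sym (trans (pullˡ _ PW.β₂) GP.β₂)))
            filler^B : ωδ ∘ (ΠW.ε ∘ LiftStrOf.fillerPoint φ q∘φ σ a b e) ≡ genFiller^B ∘ toGeneric
            filler^B = begin
              ωδ ∘ (ΠW.ε ∘ LiftStrOf.fillerPoint φ q∘φ σ a b e)  ≡⟨ cong (λ z → ωδ ∘ (ΠW.ε ∘ z)) point ⟩
              ωδ ∘ (ΠW.ε ∘ (fs ∘ toGeneric))                      ≡⟨ cong (ωδ ∘_) (pullˡ _ ε∘φ) ⟩
              ωδ ∘ (genFilled ∘ toGeneric)                        ≡⟨ pullˡ _ π₂∘pair ⟩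
              genFiller^B ∘ toGeneric                             ∎
            fillₖ-generic : LiftStrOf.fillₖ φ q∘φ σ a b e ≡ genFill ∘ prodMap B toGeneric
            fillₖ-generic = sym (PullbackFacts.⟨⟩-unique (pullback f g) _
              (begin
                PF.p₁ ∘ (genFill ∘ prodMap B toGeneric)               ≡⟨ sym (assoc _ _ _) ⟩
                (PF.p₁ ∘ genFill) ∘ prodMap B toGeneric               ≡⟨ cong (_∘ prodMap B toGeneric) (sym (EX.β _)) ⟩
                (EX.ev ∘ prodMap B genFiller^B) ∘ prodMap B toGeneric ≡⟨ assoc _ _ _ ⟩
                EX.ev ∘ (prodMap B genFiller^B ∘ prodMap B toGeneric) ≡⟨ cong (EX.ev ∘_) (prodMap-∘≡ B (sym filler^B)) ⟩
                LiftStrOf.filler φ q∘φ σ a b e                        ∎)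
              (trans (pullˡ _ (down genσ genTop genBottom gen-commutes)) genBottom-toGeneric))

        φ-unique : ∀ (k : Hom Z^B ΠW.P) (ek : ΠW.q ∘ k ≡ g^B) →
                   genFill ≡ LiftStrOf.fillₖ k ek genσ genTop genBottom gen-commutes → k ≡ φ
        φ-unique k ek eq = φ-universal k ek (⊗-ext _ _ efst esnd)
          where
            fs : Hom G (Pb ΠW.q prob-γ)
            fs = fstar prob-γ ΠW.q g^B k ek
            efst : ωσ ∘ (ΠW.ε ∘ fs) ≡ ωσ ∘ genFilled
            efst = begin
              ωσ ∘ (ΠW.ε ∘ fs)                ≡⟨ sym (prob-σ∘filled∘ _) ⟩
              prob-σ ∘ (filled ∘ (ΠW.ε ∘ fs))  ≡⟨ cong (prob-σ ∘_) (trans (pullˡ fs ΠW.ε-over) PW.β₂) ⟩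
              genσ                            ≡⟨ sym π₁∘pair ⟩
              ωσ ∘ genFilled                  ∎
            squareProb-generic : squareProb genσ genTop genBottom gen-commutes ≡ GP.p₂
            squareProb-generic = sym (classify-unique genσ _ _ (square-commutes genσ genTop genBottom gen-commutes)
              GP.p₂ refl (trans (sym GP.comm) (cong (g^B ∘_) (sym (EZ.curry-ev GP.p₁))))
              (trans (prob-topAt-self GP.p₂) (sym PF.β₁)))
            point : LiftStrOf.fillerPoint k ek genσ genTop genBottom gen-commutes ≡ fs
            point = PW.uniq _ _
              (trans PW.β₁ (trans (cong (k ∘_) (EZ.curry-ev GP.p₁)) (sym PW.β₁)))
              (trans PW.β₂ (trans squareProb-generic (sym PW.β₂)))
            esnd : ωδ ∘ (ΠW.ε ∘ fs) ≡ ωδ ∘ genFilled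
            esnd = begin
              ωδ ∘ (ΠW.ε ∘ fs)                                           ≡⟨ cong (λ z → ωδ ∘ (ΠW.ε ∘ z)) (sym point) ⟩
              ωδ ∘ (ΠW.ε ∘ LiftStrOf.fillerPoint k ek genσ genTop genBottom gen-commutes) ≡⟨ sym (EX.curry-ev _) ⟩
              EX.curry (LiftStrOf.filler k ek genσ genTop genBottom gen-commutes)
                ≡⟨ EX.curry-cong (sym (trans (cong (PF.p₁ ∘_) eq) PF.β₁)) ⟩
              genFiller^B                                                ≡⟨ sym π₂∘pair ⟩
              ωδ ∘ genFilled                                             ∎

    fillₖ-cong : ∀ {Z} (g : Hom Z Y) {k k' : Hom (Over.Z^B g) ΠW.P}
                 (ek : ΠW.q ∘ k ≡ Over.g^B g) (ek' : ΠW.q ∘ k' ≡ Over.g^B g) → k ≡ k' →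
                 ∀ {K} (σ : Hom K I) a b .(e : Over.PF.p₂ g ∘ a ≡ b ∘ σm σ) →
                 Over.LiftStrOf.fillₖ g k ek σ a b e ≡ Over.LiftStrOf.fillₖ g k' ek' σ a b e
    fillₖ-cong g ek ek' refl σ a b e = refl

    liftStrOf-restriction :
      ∀ {Z Z₀} (g : Hom Z Y) (g₀ : Hom Z₀ Y) (h : Hom Z Z₀) (eh : g₀ ∘ h ≡ g)
        (k₀ : Hom (Over.Z^B g₀) ΠW.P) (ek₀ : ΠW.q ∘ k₀ ≡ Over.g^B g₀)
        (ek : ΠW.q ∘ (k₀ ∘ expMap Lc B h) ≡ Over.g^B g) →
        IsRestriction f g g₀ h eh (Over.LiftStrOf.liftStr g (k₀ ∘ expMap Lc B h) ek)
                                  (Over.LiftStrOf.liftStr g₀ k₀ ek₀)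
    liftStrOf-restriction {Z} {Z₀} g g₀ h eh k₀ ek₀ ek {K} σ a b e = P₀.uniq _ _
        (begin
          P₀.p₁ ∘ (Phh ∘ F)                              ≡⟨ pullˡ _ P₀.β₁ ⟩
          P.p₁ ∘ F                                       ≡⟨ P.β₁ ⟩
          Over.LiftStrOf.filler g (k₀ ∘ expMap Lc B h) ek σ a b e
                                                         ≡⟨ cong (λ z → EX.ev ∘ prodMap B (ωδ ∘ (ΠW.ε ∘ z))) point ⟩
          Over.LiftStrOf.filler g₀ k₀ ek₀ σ (Phh ∘ a) (h ∘ b) e₀ ≡⟨ sym P₀.β₁ ⟩
          P₀.p₁ ∘ F₀                                     ∎)
        (begin
          P₀.p₂ ∘ (Phh ∘ F)                              ≡⟨ pullˡ _ P₀.β₂ ⟩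
          (h ∘ P.p₂) ∘ F                                 ≡⟨ assoc _ _ _ ⟩
          h ∘ (P.p₂ ∘ F)                                 ≡⟨ cong (h ∘_) P.β₂ ⟩
          h ∘ b                                          ≡⟨ sym P₀.β₂ ⟩
          P₀.p₂ ∘ F₀                                     ∎)
      where
        module P = Pullback (pullback f g)
        module P₀ = Pullback (pullback f g₀)
        module EZ = Exp B Z
        module EZ₀ = Exp B Z₀
        Phh : Hom P.P P₀.P
        Phh = Ph f g g₀ h eh
        e₀ : P₀.p₂ ∘ (Phh ∘ a) ≡ (h ∘ b) ∘ σm σ
        e₀ = PhSq f g g₀ h eh σ a b e
        F : Hom (K ⊗ B) P.P
        F = Over.LiftStrOf.fillₖ g (k₀ ∘ expMap Lc B h) ek σ a b e
        F₀ : Hom (K ⊗ B) P₀.P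
        F₀ = Over.LiftStrOf.fillₖ g₀ k₀ ek₀ σ (Phh ∘ a) (h ∘ b) e₀
        bottom : Over.g^B g ∘ EZ.curry b ≡ Over.g^B g₀ ∘ EZ₀.curry (h ∘ b)
        bottom = trans (expMap∘curry B g b)
          (sym (trans (expMap∘curry B g₀ _) (EY.curry-cong (trans (sym (assoc _ _ _)) (cong (_∘ b) eh)))))
        problem : Over.squareProb g σ a b e ≡ Over.squareProb g₀ σ (Phh ∘ a) (h ∘ b) e₀
        problem = classify-cong σ (Over.square-commutes g σ a b e) (Over.square-commutes g₀ σ (Phh ∘ a) (h ∘ b) e₀)
                    bottom (sym (pullˡ _ P₀.β₁))
        point : Over.LiftStrOf.fillerPoint g (k₀ ∘ expMap Lc B h) ek σ a b e
                  ≡ Over.LiftStrOf.fillerPoint g₀ k₀ ek₀ σ (Phh ∘ a) (h ∘ b) e₀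
        point = PullbackFacts.⟨⟩-cong₂ (pullback ΠW.q prob-γ)
                  (trans (assoc _ _ _) (cong (k₀ ∘_) (expMap∘curry B h b))) problem

  module TinyFacts (Lc : LCCCStr) {B : Obj} (tiny : IsTiny Lc B) where
    open ExponentialFacts Lc

    module RightAdjoint (T : Obj) where
      R : Obj
      R = proj₁ (tiny T)

      counit : Hom (expObj Lc B R) T
      counit = proj₁ (proj₂ (tiny T))

      transpose : ∀ {S} → Hom (expObj Lc B S) T → Hom S R
      transpose {S} k = proj₁ (proj₂ (proj₂ (tiny T)) S k)

      counit-transpose : ∀ {S} (k : Hom (expObj Lc B S) T) → counit ∘ expMap Lc B (transpose k) ≡ k
      counit-transpose {S} k = proj₁ (proj₂ (proj₂ (proj₂ (tiny T)) S k))

      transpose-unique : ∀ {S} (k : Hom (expObj Lc B S) T) (t : Hom S R) →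
                         counit ∘ expMap Lc B t ≡ k → t ≡ transpose k
      transpose-unique {S} k = proj₂ (proj₂ (proj₂ (proj₂ (tiny T)) S k))

      counit-∘ : ∀ {S S'} {t : Hom S R} {k : Hom (expObj Lc B S) T} (t' : Hom S' S) →
                 counit ∘ expMap Lc B t ≡ k → counit ∘ expMap Lc B (t ∘ t') ≡ k ∘ expMap Lc B t'
      counit-∘ t' e = trans (cong (counit ∘_) (expMap-∘ B _ t')) (pullˡ _ e)

    -- Maps Z^B → W over Y^B correspond to maps Z → R W over R(Y^B) lying over the unit
    -- Y → R(Y^B), i.e. to maps Z → Z₀ over Y.
    module OverExponential {Y W : Obj} (q : Hom W (expObj Lc B Y)) where
      module RW = RightAdjoint W
      module RY = RightAdjoint (expObj Lc B Y)

      module PZ = Pullback (pullback (RY.transpose (q ∘ RW.counit)) (RY.transpose {Y} id))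

      Z₀ : Obj
      Z₀ = PZ.P

      g₀ : Hom Z₀ Y
      g₀ = PZ.p₂

      k₀ : Hom (expObj Lc B Z₀) W
      k₀ = RW.counit ∘ expMap Lc B PZ.p₁

      q∘k₀ : q ∘ k₀ ≡ expMap Lc B g₀
      q∘k₀ = begin
        q ∘ (RW.counit ∘ expMap Lc B PZ.p₁)                               ≡⟨ sym (assoc _ _ _) ⟩
        (q ∘ RW.counit) ∘ expMap Lc B PZ.p₁                               ≡⟨ sym (RY.counit-∘ PZ.p₁ (RY.counit-transpose _)) ⟩
        RY.counit ∘ expMap Lc B (RY.transpose (q ∘ RW.counit) ∘ PZ.p₁)    ≡⟨ cong (λ z → RY.counit ∘ expMap Lc B z) PZ.comm ⟩
        RY.counit ∘ expMap Lc B (RY.transpose id ∘ g₀)                    ≡⟨ RY.counit-∘ g₀ (RY.counit-transpose id) ⟩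
        id ∘ expMap Lc B g₀                                               ≡⟨ idˡ _ ⟩
        expMap Lc B g₀                                                    ∎

      q∘k₀∘ : ∀ {Z} (g : Hom Z Y) (h : Hom Z Z₀) → g₀ ∘ h ≡ g → q ∘ (k₀ ∘ expMap Lc B h) ≡ expMap Lc B g
      q∘k₀∘ g h eh = trans (pullˡ _ q∘k₀) (trans (sym (expMap-∘ B g₀ h)) (cong (expMap Lc B) eh))

      k₀∘expMap : ∀ {Z} (h : Hom Z Z₀) → k₀ ∘ expMap Lc B h ≡ RW.counit ∘ expMap Lc B (PZ.p₁ ∘ h)
      k₀∘expMap h = trans (assoc _ _ _) (cong (RW.counit ∘_) (sym (expMap-∘ B PZ.p₁ h)))

      module Factor {Z} (g : Hom Z Y) (k : Hom (expObj Lc B Z) W) (ek : q ∘ k ≡ expMap Lc B g) where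
        transpose-over : RY.transpose (q ∘ RW.counit) ∘ RW.transpose k ≡ RY.transpose id ∘ g
        transpose-over = trans (RY.transpose-unique _ _ via-k) (sym (RY.transpose-unique _ _ via-g))
          where
            via-k : RY.counit ∘ expMap Lc B (RY.transpose (q ∘ RW.counit) ∘ RW.transpose k) ≡ expMap Lc B g
            via-k = trans (RY.counit-∘ _ (RY.counit-transpose _))
                      (trans (assoc _ _ _) (trans (cong (q ∘_) (RW.counit-transpose k)) ek))
            via-g : RY.counit ∘ expMap Lc B (RY.transpose id ∘ g) ≡ expMap Lc B g
            via-g = trans (RY.counit-∘ g (RY.counit-transpose id)) (idˡ _)

        factor : Hom Z Z₀
        factor = PZ.⟨ RW.transpose k , g ⟩ transpose-over

        g₀∘factor : g₀ ∘ factor ≡ g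
        g₀∘factor = PZ.β₂

        k₀∘factor : k₀ ∘ expMap Lc B factor ≡ k
        k₀∘factor = trans (k₀∘expMap factor)
          (trans (cong (λ z → RW.counit ∘ expMap Lc B z) PZ.β₁) (RW.counit-transpose k))

        factor-unique : (h : Hom Z Z₀) → g₀ ∘ h ≡ g → k₀ ∘ expMap Lc B h ≡ k → h ≡ factor
        factor-unique h eh ekh = PZ.uniq _ _
          (trans (RW.transpose-unique k _ (trans (sym (k₀∘expMap h)) ekh)) (sym PZ.β₁))
          (trans eh (sym PZ.β₂))

  module Definability (Lc : LCCCStr) (B : Obj) (tiny : IsTiny Lc B) (I A : Obj) (m : Hom A (I ⊗ B))
                      {X Y : Obj} (f : Hom X Y) where
    open Lifting I B A m
    open LiftStrClassifier Lc B I A m f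
    open TinyFacts Lc tiny
    open OverExponential ΠW.q

    s₀ : LiftStr (pr₂ {f = f} {g = g₀})
    s₀ = Over.LiftStrOf.liftStr g₀ k₀ q∘k₀

    module _ {Z : Obj} (g : Hom Z Y) (s : LiftStr (pr₂ {f = f} {g = g})) where
      open Over g
      open ClassifyLiftStr s
      open Factor g φ q∘φ

      restricts-if-classifies : ∀ (h : Hom Z Z₀) (eh : g₀ ∘ h ≡ g) → k₀ ∘ expMap Lc B h ≡ φ →
                          IsRestriction f g g₀ h eh s s₀
      restricts-if-classifies h eh kh σ a b e = begin
        Ph f g g₀ h eh ∘ LiftStr.fill s σ a b e
          ≡⟨ cong (Ph f g g₀ h eh ∘_) (sym (fillₖ-φ σ a b e)) ⟩
        Ph f g g₀ h eh ∘ LiftStrOf.fillₖ φ q∘φ σ a b e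
          ≡⟨ cong (Ph f g g₀ h eh ∘_) (fillₖ-cong g q∘φ (q∘k₀∘ g h eh) (sym kh) σ a b e) ⟩
        Ph f g g₀ h eh ∘ LiftStrOf.fillₖ (k₀ ∘ expMap Lc B h) (q∘k₀∘ g h eh) σ a b e
          ≡⟨ liftStrOf-restriction g g₀ h eh k₀ q∘k₀ (q∘k₀∘ g h eh) σ a b e ⟩
        LiftStr.fill s₀ σ (Ph f g g₀ h eh ∘ a) (h ∘ b) (PhSq f g g₀ h eh σ a b e) ∎

      -- The filler of the generic square determines the classifying map.
      classifies-if-restricts : ∀ (h : Hom Z Z₀) (eh : g₀ ∘ h ≡ g) → IsRestriction f g g₀ h eh s s₀ →
                          k₀ ∘ expMap Lc B h ≡ φ
      classifies-if-restricts h eh isR = φ-unique (k₀ ∘ expMap Lc B h) (q∘k₀∘ g h eh) (PF.uniq _ _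
          (trans (sym (pullˡ _ P₀.β₁)) (trans (cong (P₀.p₁ ∘_) restricts) (pullˡ _ P₀.β₁)))
          (trans (down genσ genTop genBottom gen-commutes) (sym PF.β₂)))
        where
          open LiftStr s
          module P₀ = Pullback (pullback f g₀)
          restricts : Ph f g g₀ h eh ∘ genFill
                        ≡ Ph f g g₀ h eh ∘ LiftStrOf.fillₖ (k₀ ∘ expMap Lc B h) (q∘k₀∘ g h eh)
                                             genσ genTop genBottom gen-commutes
          restricts = trans (isR genσ genTop genBottom gen-commutes)
            (sym (liftStrOf-restriction g g₀ h eh k₀ q∘k₀ (q∘k₀∘ g h eh) genσ genTop genBottom gen-commutes))

      universal : Σ (Hom Z Z₀) λ h → Σ (g₀ ∘ h ≡ g) λ eh →
                    IsRestriction f g g₀ h eh s s₀ ×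
                    (∀ (h' : Hom Z Z₀) (eh' : g₀ ∘ h' ≡ g) → IsRestriction f g g₀ h' eh' s s₀ → h' ≡ h)
      universal = factor , g₀∘factor , restricts-if-classifies factor g₀∘factor k₀∘factor ,
                  λ h' eh' isR' → factor-unique h' eh' (classifies-if-restricts h' eh' isR')

    representable : RepresentableLiftStr f
    representable = Z₀ , g₀ , s₀ , universal

mainTheorem3 : ∀ {o ℓ : Level} (C : Category o ℓ) (FL : Limits.FinLim C)
               (L : Constructions.LCCCStr C FL) (B : Category.Obj C) →
               Constructions.IsTiny C FL L B →
               (I A : Category.Obj C) (m : Category.Hom C A (Constructions._⊗_ C FL I B)) →
               Constructions.Lifting.Definable C FL I B A m
mainTheorem3 C FL L B tiny I A m f = Definability.representable C FL L B tiny I A m f
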